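{- Let $p$ be a prime and $n\ge p-1$ an integer with $n\ge 3$. Let $M$ be an $n$-spike representable over $GF(p)$ and let $A$ be a special standard representation of $M$ over $GF(p)$ with diagonal $\vec x=(x_1,\dots,x_n)$. Then $\vec x$ is weakly equivalent to a diagonal whose first entry is $-1$.
   Context: For an integer $n\ge 3$, a matroid $M$ is an $n$-spike (with tip $t$) if (i) its ground set is the union of $n$ lines $L_1,\dots,L_n$, each having exactly three points and all passing through a common point $t$; (ii) $r(L_1\cup\cdots\cup L_k)=k+1$ for all $k\in\{1,\dots,n-1\}$; and (iii) $r(L_1\cup\cdots\cup L_n)=n$. Two non-tip elements on the same line $L_i$ are called conjugate. If $M$ is representable over a field $F$ and $\{b_1,\dots,b_n\}$ is a basis with $b_i\in L_i\setminus\{t\}$ (the distinguished basis), then $M$ is represented over $F$ by an $n\times(2n+1)$ matrix $[I_n\mid \mathbf{1}\mid B]$, where column $i$ ($1\le i\le n$) corresponds to $b_i$, column $n+1$ is the all-ones vector and corresponds to the tip $t$, and column $n+1+i$ corresponds to the conjugate $c_i$ of $b_i$ and equals the all-ones vector plus $x_i$ times the $i$-th standard unit vector, where $x_i\in F$ (necessarily $x_i\neq 0$). Such a matrix is a special standard representation, and $\vec x=(x_1,\dots,x_n)$ is its diagonal. Two matrix representations are weakly equivalent if one is obtained from the other by a sequence of: interchanging rows, scaling a row by a nonzero scalar, adding one row to another, interchanging columns, scaling a column by a nonzero scalar, applying a field automorphism to all entries, and relabeling columns. Two diagonals are weakly equivalent if their corresponding special standard representations are weakly equivalent. -}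

module Defs where

open import Data.Nat as ℕ using (ℕ; zero; suc; NonZero; _∸_; _≤_; _<?_)
open import Data.Nat.DivMod using (_mod_)
open import Data.Fin as Fin using (Fin; toℕ; splitAt; _↑ˡ_; _↑ʳ_; _≟_)
open import Data.Fin.Subset using (Subset; _∉_; _⊆_; _∪_; ⁅_⁆; ⋃; ∣_∣; ⊤)
open import Data.List as List using (List; allFin)
open import Data.Sum using (_⊎_; inj₁; inj₂)
open import Data.Product using (Σ; _×_; ∃)
open import Relation.Nullary using (¬_; yes; no)
open import Relation.Binary.PropositionalEquality using (_≡_; _≢_)
open import Relation.Binary.Construct.Closure.ReflexiveTransitive using (Star)

GF : ℕ → Set
GF p = Fin p

module _ {p : ℕ} {{_ : NonZero p}} where

  0F 1F -1F : GF p
  0F  = 0 mod p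
  1F  = 1 mod p
  -1F = (p ∸ 1) mod p

  _+F_ _*F_ : GF p → GF p → GF p
  a +F b = (toℕ a ℕ.+ toℕ b) mod p
  a *F b = (toℕ a ℕ.* toℕ b) mod p

  sumF : {m : ℕ} → (Fin m → GF p) → GF p
  sumF {zero}  f = 0F
  sumF {suc m} f = f Fin.zero +F sumF (λ j → f (Fin.suc j))

  record IsFieldAutomorphism (σ : GF p → GF p) : Set where
    field
      injective  : ∀ a b → σ a ≡ σ b → a ≡ b
      surjective : ∀ b → ∃ λ a → σ a ≡ b
      pres-+     : ∀ a b → σ (a +F b) ≡ σ a +F σ b
      pres-*     : ∀ a b → σ (a *F b) ≡ σ a *F σ b
      pres-1     : σ 1F ≡ 1F

  Matrix : ℕ → ℕ → Set
  Matrix r m = Fin r → Fin m → GF p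

  Independent : {r m : ℕ} → Matrix r m → Subset m → Set
  Independent {r} {m} A S =
    (c : Fin m → GF p) → (∀ j → j ∉ S → c j ≡ 0F) →
    (∀ row → sumF (λ j → c j *F A row j) ≡ 0F) → ∀ j → c j ≡ 0F

  HasRank : {r m : ℕ} → Matrix r m → Subset m → ℕ → Set
  HasRank A S k =
    (Σ (Subset _) λ I → I ⊆ S × Independent A I × ∣ I ∣ ≡ k) ×
    (∀ J → J ⊆ S → Independent A J → ∣ J ∣ ≤ k)

  swapIdx : {k : ℕ} → Fin k → Fin k → Fin k → Fin k
  swapIdx i j x with x ≟ i
  ... | yes _ = j
  ... | no _ with x ≟ j
  ...   | yes _ = i
  ...   | no _ = x

  data WeakStep {r m : ℕ} (A B : Matrix r m) : Set where
    rowSwap  : (i j : Fin r) →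
               (∀ x y → B x y ≡ A (swapIdx i j x) y) → WeakStep A B
    rowScale : (i : Fin r) (a : GF p) → a ≢ 0F →
               (∀ y → B i y ≡ a *F A i y) →
               (∀ x y → x ≢ i → B x y ≡ A x y) → WeakStep A B
    rowAdd   : (i j : Fin r) → i ≢ j →
               (∀ y → B i y ≡ A i y +F A j y) →
               (∀ x y → x ≢ i → B x y ≡ A x y) → WeakStep A B
    colSwap  : (i j : Fin m) →
               (∀ x y → B x y ≡ A x (swapIdx i j y)) → WeakStep A B
    colScale : (j : Fin m) (a : GF p) → a ≢ 0F →
               (∀ x → B x j ≡ a *F A x j) →
               (∀ x y → y ≢ j → B x y ≡ A x y) → WeakStep A B
    fieldAut : (σ : GF p → GF p) → IsFieldAutomorphism σ →
               (∀ x y → B x y ≡ σ (A x y)) → WeakStep A B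

  WeakEquiv : {r m : ℕ} → Matrix r m → Matrix r m → Set
  WeakEquiv = Star WeakStep

  -- Spikes and special standard representations.
  -- Columns are indexed by Fin (n + suc n): the first n are b_1..b_n,
  -- then the tip t, then c_1..c_n.

  colB colC : {n : ℕ} → Fin n → Fin (n ℕ.+ suc n)
  colB {n} i = i ↑ˡ suc n
  colC {n} i = n ↑ʳ Fin.suc i

  colT : {n : ℕ} → Fin (n ℕ.+ suc n)
  colT {n} = n ↑ʳ Fin.zero

  Line : {n : ℕ} → Fin n → Subset (n ℕ.+ suc n)
  Line i = (⁅ colB i ⁆ ∪ ⁅ colT ⁆) ∪ ⁅ colC i ⁆

  PrefixLines : (n k : ℕ) → Subset (n ℕ.+ suc n)
  PrefixLines n k = ⋃ (List.map Line (List.filter (λ i → toℕ i <? k) (allFin n)))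

  IsSpikeRep : (n : ℕ) → Matrix n (n ℕ.+ suc n) → Set
  IsSpikeRep n A =
    (∀ i → HasRank A (Line i) 2) ×
    (∀ k → 1 ≤ k → k ≤ n ∸ 1 → HasRank A (PrefixLines n k) (suc k)) ×
    HasRank A ⊤ n

  -- the special standard matrix [I_n | 1 | B] with diagonal x
  ssr : {n : ℕ} → (Fin n → GF p) → Matrix n (n ℕ.+ suc n)
  ssr {n} x row col with splitAt n col
  ... | inj₁ i with i ≟ row
  ...   | yes _ = 1F
  ...   | no _  = 0F
  ssr {n} x row col | inj₂ Fin.zero = 1F
  ssr {n} x row col | inj₂ (Fin.suc i) with i ≟ row
  ...   | yes _ = 1F +F x i
  ...   | no _  = 1F

  IsDiagonal : (n : ℕ) → (Fin n → GF p) → Set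
  IsDiagonal n x = (∀ i → x i ≢ 0F) × IsSpikeRep n (ssr x)

module Submission where

-- Exchanging the roles of b_i and c_i in a special standard representation with
-- diagonal x and row-reducing back to the form [I | 1 | B] yields the diagonal with
-- entry -(1 + x_i) at i and x_j (1 + x_i) / x_i at j ≠ i; this needs x_i ∉ {0, -1}.
-- Writing x_j = d / v_j, this flip replaces the homogeneous coordinates (d : v) by
-- (d + v_i : v with v_i negated).  Start from (1 : u) with u_j = 1 / x_j.  Since
-- n ≥ p - 1 nonzero elements of GF(p) have every element as a subset sum (the set of
-- subset sums grows with each summand until it is closed under adding it), there are
-- distinct k, i_1, ..., i_m with u_k + u_{i_1} + ... + u_{i_m} = -1.  Flipping at
-- i_1, ..., i_m in turn leaves d = -u_k, so the k-th entry becomes -1; a flip that is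
-- blocked because an entry already equals -1 only ends the walk early.  Permuting the
-- indices moves the -1 to the front.  The rank conditions of a spike hold for
-- [I | 1 | B] whatever the diagonal, so the result again represents a spike.

open import Defs
open import Algebra.Bundles using (CommutativeRing)
open import Algebra.Structures using (IsCommutativeRing)
import Algebra.Properties.Ring as RingProperties
import Algebra.Properties.Semiring.Sum as Semiring-Sum
import Algebra.Solver.Ring as RingSolver
import Algebra.Solver.Ring.AlmostCommutativeRing as ACR
open import Data.Bool using (true; false; if_then_else_)
open import Data.Empty using (⊥-elim)
open import Data.Fin as Fin using (Fin; toℕ; fromℕ<; splitAt; _↑ˡ_; _↑ʳ_)
open import Data.Fin.Properties as Fin
  using (any?; toℕ-injective; toℕ<n; toℕ-fromℕ<; splitAt-↑ˡ; splitAt-↑ʳ; join-splitAt)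
open import Data.Fin.Subset as Sub using (Subset; inside; outside; _∈_; _∉_; _⊆_; _∪_; ⁅_⁆; ⋃; ∣_∣; Nonempty)
open import Data.Fin.Subset.Properties using (p─⊥≡p; ∪-identityʳ; ∈⊤; ∣⊤∣≡n; p⊆p∪q; p⊂q⇒∣p∣<∣q∣; p⊆q⇒∣p∣≤∣q∣; x∉p⇒x∈∁p; ∣∁p∣≡n∸∣p∣; ∉⊥; x∈p∪q⁻; x∈p∪q⁺; x∈⁅x⁆; x∈⁅y⁆⇒x≡y; ∣⁅x⁆∣≡1; nonempty?; Empty-unique; ∣⊥∣≡0; x∈p∧x≢y⇒x∈p-y; x∈p⇒∣p-x∣<∣p∣; p─q⊆p; _∈?_)
open import Data.Integer as ℤ using (ℤ)
import Data.Integer.Properties as ℤ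
open import Data.List using (List; []; _∷_; allFin; foldr; map)
import Data.List.Properties as List
open import Data.List.Membership.Propositional using (find; lose)
open import Data.List.Membership.Propositional.Properties using (∈-filter⁺; ∈-filter⁻; ∈-allFin)
open import Data.List.Relation.Unary.All as All using (All; []; _∷_)
import Data.List.Relation.Unary.All.Properties as All
open import Data.List.Relation.Unary.AllPairs using ([]; _∷_)
open import Data.List.Relation.Unary.Any as Any using (Any)
import Data.List.Relation.Unary.Any.Properties as Any
open import Data.List.Relation.Unary.Unique.Propositional using (Unique)
import Data.List.Relation.Unary.Unique.Propositional.Properties as Unique
open import Data.Maybe as Maybe using (Maybe)
open import Data.Nat as ℕ using (ℕ; zero; suc; NonZero; _≤_; _<_; _∸_; _%_; z≤n; s≤s)
import Data.Nat.Properties as ℕ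
open import Data.Nat.Coprimality using (prime⇒coprime; coprime-Bézout)
open import Data.Nat.DivMod using (_mod_; %-distribˡ-+; %-distribˡ-*; n%n≡0; m*n%n≡0; m<n⇒m%n≡m; [m+kn]%n≡m%n)
open import Data.Nat.GCD using (module Bézout)
open import Data.Nat.Primality using (Prime; prime⇒nonTrivial)
open import Data.Product using (Σ; _×_; _,_; ∃; proj₁; proj₂)
open import Data.Sum using (_⊎_; inj₁; inj₂; [_,_]′)
open import Data.Vec using ([]; _∷_; _++_; here; there; tabulate; lookup)
open import Data.Vec.Properties using (lookup∘tabulate; lookup⇒[]=; []=⇒lookup)
open import Function using (_∘_; id; case_of_)
open import Relation.Binary.Construct.Closure.ReflexiveTransitive using (ε; _◅_; _◅◅_)
open import Relation.Binary.PropositionalEquality hiding ([_])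
open import Relation.Nullary using (¬_; ¬?; Dec; yes; no; contradiction; _×-dec_; dec⇒maybe)
open import Relation.Nullary.Decidable using (does; dec-true; dec-false)

if-≟-≡ : ∀ {a} {A : Set a} {k} (i : Fin k) {u v : A} → (if does (i Fin.≟ i) then u else v) ≡ u
if-≟-≡ i = cong (if_then _ else _) (dec-true (i Fin.≟ i) refl)

if-≟-≢ : ∀ {a} {A : Set a} {k} {x i : Fin k} {u v : A} → x ≢ i → (if does (x Fin.≟ i) then u else v) ≡ v
if-≟-≢ {x = x} {i} x≢i = cong (if_then _ else _) (dec-false (x Fin.≟ i) x≢i)

x∉p-x : ∀ {n} (p : Subset n) x → x ∉ p Sub.- x
x∉p-x (_ ∷ p) Fin.zero    ()
x∉p-x (_ ∷ p) (Fin.suc x) (there x∈p-x) = x∉p-x p x x∈p-x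

∣p-x∣+1≡∣p∣ : ∀ {n} {p : Subset n} {x} → x ∈ p → suc ∣ p Sub.- x ∣ ≡ ∣ p ∣
∣p-x∣+1≡∣p∣ {p = inside ∷ p}  {Fin.zero}  here           = cong (suc ∘ ∣_∣) (p─⊥≡p p)
∣p-x∣+1≡∣p∣ {p = outside ∷ p} {Fin.suc x} (there x∈p) = ∣p-x∣+1≡∣p∣ x∈p
∣p-x∣+1≡∣p∣ {p = inside ∷ p}  {Fin.suc x} (there x∈p) = cong suc (∣p-x∣+1≡∣p∣ x∈p)

0<∣p∣⇒nonempty : ∀ {n} (p : Subset n) → 0 < ∣ p ∣ → Nonempty p
0<∣p∣⇒nonempty {n} p 0<∣p∣ with nonempty? p
... | yes ne = ne
... | no ¬ne = contradiction (trans (cong ∣_∣ (Empty-unique ¬ne)) (∣⊥∣≡0 n)) (ℕ.>⇒≢ 0<∣p∣)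

∣p∪⁅x⁆∣≡1+∣p∣ : ∀ {n} {p : Subset n} {x} → x ∉ p → ∣ p ∪ ⁅ x ⁆ ∣ ≡ suc ∣ p ∣
∣p∪⁅x⁆∣≡1+∣p∣ {p = outside ∷ p} {Fin.zero}  _   = cong (suc ∘ ∣_∣) (∪-identityʳ p)
∣p∪⁅x⁆∣≡1+∣p∣ {p = inside ∷ p}  {Fin.zero}  x∉p = contradiction here x∉p
∣p∪⁅x⁆∣≡1+∣p∣ {p = outside ∷ p} {Fin.suc x} x∉p = ∣p∪⁅x⁆∣≡1+∣p∣ (x∉p ∘ there)
∣p∪⁅x⁆∣≡1+∣p∣ {p = inside ∷ p}  {Fin.suc x} x∉p = cong suc (∣p∪⁅x⁆∣≡1+∣p∣ (x∉p ∘ there))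

∣p++q∣ : ∀ {m n} (p : Subset m) (q : Subset n) → ∣ p ++ q ∣ ≡ ∣ p ∣ ℕ.+ ∣ q ∣
∣p++q∣ []            q = refl
∣p++q∣ (inside ∷ p)  q = cong suc (∣p++q∣ p q)
∣p++q∣ (outside ∷ p) q = ∣p++q∣ p q

∈-++ˡ⁻ : ∀ {m n} {p : Subset m} {q : Subset n} {i} → (i ↑ˡ n) ∈ p ++ q → i ∈ p
∈-++ˡ⁻ {p = _ ∷ _} {i = Fin.zero}  here        = here
∈-++ˡ⁻ {p = _ ∷ _} {i = Fin.suc i} (there i∈p) = there (∈-++ˡ⁻ i∈p)

∈-++ʳ⁻ : ∀ {m n} {p : Subset m} {q : Subset n} {j} → (m ↑ʳ j) ∈ p ++ q → j ∈ q
∈-++ʳ⁻ {p = []}    j∈q         = j∈q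
∈-++ʳ⁻ {p = _ ∷ _} (there j∈q) = ∈-++ʳ⁻ j∈q

x∈⋃⁻ : ∀ {n} (ps : List (Subset n)) {x} → x ∈ ⋃ ps → Any (x ∈_) ps
x∈⋃⁻ []       x∈⊥ = contradiction x∈⊥ ∉⊥
x∈⋃⁻ (p ∷ ps) x∈ = [ Any.here , Any.there ∘ x∈⋃⁻ ps ]′ (x∈p∪q⁻ p (⋃ ps) x∈)

x∈⋃⁺ : ∀ {n} {ps : List (Subset n)} {x} → Any (x ∈_) ps → x ∈ ⋃ ps
x∈⋃⁺ (Any.here x∈p)   = x∈p∪q⁺ (inj₁ x∈p)
x∈⋃⁺ (Any.there x∈ps) = x∈p∪q⁺ (inj₂ (x∈⋃⁺ x∈ps))

below : ∀ {n} → ℕ → Subset n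
below {zero}  _       = []
below {suc n} zero    = Sub.⊥
below {suc n} (suc k) = inside ∷ below k

∈below⁻ : ∀ {n k} {i : Fin n} → i ∈ below k → toℕ i < k
∈below⁻ {suc n} {zero}  i∈⊥         = contradiction i∈⊥ ∉⊥
∈below⁻ {suc n} {suc k} here        = s≤s z≤n
∈below⁻ {suc n} {suc k} (there i∈) = s≤s (∈below⁻ i∈)

∈below⁺ : ∀ {n k} {i : Fin n} → toℕ i < k → i ∈ below k
∈below⁺ {suc n} {suc k} {Fin.zero}  _        = here
∈below⁺ {suc n} {suc k} {Fin.suc i} (s≤s lt) = there (∈below⁺ lt)

∣below∣ : ∀ {n k} → k ≤ n → ∣ below {n} k ∣ ≡ k
∣below∣ {zero}  z≤n           = refl
∣below∣ {suc n} {zero}  _     = ∣⊥∣≡0 (suc n)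
∣below∣ {suc n} {suc k} (s≤s k≤n) = cong suc (∣below∣ k≤n)

n∸1<n : ∀ {n} → 0 < n → n ∸ 1 < n
n∸1<n {suc n} _ = ℕ.n<1+n n

another : ∀ {n} → 2 ≤ n → (i : Fin n) → ∃ λ j → i ≢ j
another (s≤s (s≤s z≤n)) Fin.zero    = Fin.suc Fin.zero , λ ()
another (s≤s (s≤s z≤n)) (Fin.suc i) = Fin.zero , λ ()

-- The ring GF(p)

module _ {p : ℕ} {{_ : NonZero p}} where

  toℕ-mod : ∀ m → toℕ (m mod p) ≡ m % p
  toℕ-mod m = toℕ-fromℕ< _

  mod-toℕ : ∀ (a : GF p) → toℕ a mod p ≡ a
  mod-toℕ a = toℕ-injective (trans (toℕ-mod _) (m<n⇒m%n≡m (toℕ<n a)))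

  p-mod-p : p mod p ≡ 0F
  p-mod-p = toℕ-injective (trans (toℕ-mod p) (trans (n%n≡0 p) (sym (trans (toℕ-mod 0) (m*n%n≡0 0 p)))))

  infixl 6 _+_
  infixl 7 _*_
  infix  8 -_

  -- opaque, so that the ring solver and unification do not unfold them to ℕ arithmetic
  opaque
    _+_ _*_ : GF p → GF p → GF p
    _+_ = _+F_
    _*_ = _*F_

    -_ : GF p → GF p
    - a = (p ∸ toℕ a) mod p

    +F≡+ : ∀ a b → a +F b ≡ a + b
    +F≡+ a b = refl

    *F≡* : ∀ a b → a *F b ≡ a * b
    *F≡* a b = refl

    -‿toℕ : ∀ a → - a ≡ (p ∸ toℕ a) mod p
    -‿toℕ a = refl

    mod-+ : ∀ m n → (m ℕ.+ n) mod p ≡ m mod p + n mod p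
    mod-+ m n = toℕ-injective (begin
      toℕ ((m ℕ.+ n) mod p)                   ≡⟨ toℕ-mod _ ⟩
      (m ℕ.+ n) % p                           ≡⟨ %-distribˡ-+ m n p ⟩
      (m % p ℕ.+ n % p) % p                   ≡⟨ cong₂ (λ u v → (u ℕ.+ v) % p) (toℕ-mod m) (toℕ-mod n) ⟨
      (toℕ (m mod p) ℕ.+ toℕ (n mod p)) % p   ≡⟨ toℕ-mod _ ⟨
      toℕ (m mod p + n mod p)                 ∎)
      where open ≡-Reasoning

    mod-* : ∀ m n → (m ℕ.* n) mod p ≡ (m mod p) * (n mod p)
    mod-* m n = toℕ-injective (begin
      toℕ ((m ℕ.* n) mod p)                   ≡⟨ toℕ-mod _ ⟩
      (m ℕ.* n) % p                           ≡⟨ %-distribˡ-* m n p ⟩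
      (m % p ℕ.* (n % p)) % p                 ≡⟨ cong₂ (λ u v → (u ℕ.* v) % p) (toℕ-mod m) (toℕ-mod n) ⟨
      (toℕ (m mod p) ℕ.* toℕ (n mod p)) % p   ≡⟨ toℕ-mod _ ⟨
      toℕ ((m mod p) * (n mod p))             ∎)
      where open ≡-Reasoning

    +-comm : ∀ a b → a + b ≡ b + a
    +-comm a b = cong (_mod p) (ℕ.+-comm (toℕ a) (toℕ b))

    *-comm : ∀ a b → a * b ≡ b * a
    *-comm a b = cong (_mod p) (ℕ.*-comm (toℕ a) (toℕ b))

  +-inverseʳ : ∀ a → a + - a ≡ 0F
  +-inverseʳ a = begin
    a + - a                                    ≡⟨ cong₂ _+_ (mod-toℕ a) (sym (-‿toℕ a)) ⟨
    toℕ a mod p + (p ∸ toℕ a) mod p            ≡⟨ mod-+ (toℕ a) (p ∸ toℕ a) ⟨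
    (toℕ a ℕ.+ (p ∸ toℕ a)) mod p              ≡⟨ cong (_mod p) (ℕ.m+[n∸m]≡n (ℕ.<⇒≤ (toℕ<n a))) ⟩
    p mod p                                    ≡⟨ p-mod-p ⟩
    0F                                         ∎
    where open ≡-Reasoning

  -- every element is some m mod p, so the laws of GF(p) follow from those of ℕ
  mod-elim : {P : GF p → Set} → (∀ m → P (m mod p)) → ∀ a → P a
  mod-elim {P} h a = subst P (mod-toℕ a) (h (toℕ a))

  mod-elim₃ : {P : GF p → GF p → GF p → Set} →
              (∀ l m n → P (l mod p) (m mod p) (n mod p)) → ∀ a b c → P a b c
  mod-elim₃ {P} h a b c = mod-elim (λ l → mod-elim (λ m → mod-elim (λ n → h l m n) c) b) a

  +-identityˡ : ∀ a → 0F + a ≡ a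
  +-identityˡ = mod-elim λ m → sym (mod-+ 0 m)

  *-identityˡ : ∀ a → 1F * a ≡ a
  *-identityˡ = mod-elim λ m → trans (sym (mod-* 1 m)) (cong (_mod p) (ℕ.*-identityˡ m))

  +-assoc : ∀ a b c → (a + b) + c ≡ a + (b + c)
  +-assoc = mod-elim₃ λ l m n → begin
    (l mod p + m mod p) + n mod p  ≡⟨ cong (_+ n mod p) (mod-+ l m) ⟨
    (l ℕ.+ m) mod p + n mod p      ≡⟨ mod-+ (l ℕ.+ m) n ⟨
    (l ℕ.+ m ℕ.+ n) mod p          ≡⟨ cong (_mod p) (ℕ.+-assoc l m n) ⟩
    (l ℕ.+ (m ℕ.+ n)) mod p        ≡⟨ mod-+ l (m ℕ.+ n) ⟩
    l mod p + (m ℕ.+ n) mod p      ≡⟨ cong (l mod p +_) (mod-+ m n) ⟩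
    l mod p + (m mod p + n mod p)  ∎
    where open ≡-Reasoning

  *-assoc : ∀ a b c → (a * b) * c ≡ a * (b * c)
  *-assoc = mod-elim₃ λ l m n → begin
    ((l mod p) * (m mod p)) * (n mod p)  ≡⟨ cong (_* (n mod p)) (mod-* l m) ⟨
    ((l ℕ.* m) mod p) * (n mod p)        ≡⟨ mod-* (l ℕ.* m) n ⟨
    (l ℕ.* m ℕ.* n) mod p                ≡⟨ cong (_mod p) (ℕ.*-assoc l m n) ⟩
    (l ℕ.* (m ℕ.* n)) mod p              ≡⟨ mod-* l (m ℕ.* n) ⟩
    (l mod p) * ((m ℕ.* n) mod p)        ≡⟨ cong ((l mod p) *_) (mod-* m n) ⟩
    (l mod p) * ((m mod p) * (n mod p))  ∎
    where open ≡-Reasoning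

  *-distribˡ-+ : ∀ a b c → a * (b + c) ≡ a * b + a * c
  *-distribˡ-+ = mod-elim₃ λ l m n → begin
    (l mod p) * (m mod p + n mod p)              ≡⟨ cong ((l mod p) *_) (mod-+ m n) ⟨
    (l mod p) * ((m ℕ.+ n) mod p)                ≡⟨ mod-* l (m ℕ.+ n) ⟨
    (l ℕ.* (m ℕ.+ n)) mod p                      ≡⟨ cong (_mod p) (ℕ.*-distribˡ-+ l m n) ⟩
    (l ℕ.* m ℕ.+ l ℕ.* n) mod p                  ≡⟨ mod-+ (l ℕ.* m) (l ℕ.* n) ⟩
    (l ℕ.* m) mod p + (l ℕ.* n) mod p            ≡⟨ cong₂ _+_ (mod-* l m) (mod-* l n) ⟩
    (l mod p) * (m mod p) + (l mod p) * (n mod p) ∎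
    where open ≡-Reasoning

  +-*-isCommutativeRing : IsCommutativeRing _≡_ _+_ _*_ -_ 0F 1F
  +-*-isCommutativeRing = record
    { isRing = record
      { +-isAbelianGroup = record
        { isGroup = record
          { isMonoid = record
            { isSemigroup = record
              { isMagma = record { isEquivalence = isEquivalence ; ∙-cong = cong₂ _+_ }
              ; assoc = +-assoc }
            ; identity = +-identityˡ , λ a → trans (+-comm a 0F) (+-identityˡ a) }
          ; inverse = (λ a → trans (+-comm (- a) a) (+-inverseʳ a)) , +-inverseʳ
          ; ⁻¹-cong = cong -_ }
        ; comm = +-comm }
      ; *-cong = cong₂ _*_
      ; *-assoc = *-assoc
      ; *-identity = *-identityˡ , λ a → trans (*-comm a 1F) (*-identityˡ a)
      ; distrib = *-distribˡ-+ , λ a b c → trans (*-comm (b + c) a)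
                    (trans (*-distribˡ-+ a b c) (cong₂ _+_ (*-comm a b) (*-comm a c))) }
    ; *-comm = *-comm }

  GF-commutativeRing : CommutativeRing _ _
  GF-commutativeRing = record { isCommutativeRing = +-*-isCommutativeRing }

  open CommutativeRing GF-commutativeRing public using (+-identityʳ; zeroˡ; zeroʳ; *-identityʳ)
  open RingProperties (CommutativeRing.ring GF-commutativeRing) public
    using (-0#≈0#; -‿involutive; -‿+-comm; -‿distribˡ-*; -‿distribʳ-*; +-inverseʳ-unique; +-inverseˡ-unique; xyx⁻¹≈y)

  fromℤ : ℤ → GF p
  fromℤ (ℤ.+ n)    = n mod p
  fromℤ ℤ.-[1+ n ] = - (suc n mod p)

  fromℤ-‿homo : ∀ i → fromℤ (ℤ.- i) ≡ - fromℤ i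
  fromℤ-‿homo (ℤ.+ zero)  = sym -0#≈0#
  fromℤ-‿homo ℤ.+[1+ n ]  = refl
  fromℤ-‿homo ℤ.-[1+ n ]  = sym (-‿involutive _)

  fromℤ-⊖ : ∀ m n → fromℤ (m ℤ.⊖ n) ≡ m mod p + - (n mod p)
  fromℤ-⊖ m       zero    = sym (trans (cong (m mod p +_) -0#≈0#) (+-identityʳ _))
  fromℤ-⊖ zero    (suc n) = sym (+-identityˡ _)
  fromℤ-⊖ (suc m) (suc n) = begin
    fromℤ (suc m ℤ.⊖ suc n)                       ≡⟨ cong fromℤ (ℤ.[1+m]⊖[1+n]≡m⊖n m n) ⟩
    fromℤ (m ℤ.⊖ n)                               ≡⟨ fromℤ-⊖ m n ⟩
    a + - b                                       ≡⟨ cong (_+ - b) (xyx⁻¹≈y c a) ⟨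
    c + a + - c + - b                             ≡⟨ +-assoc (c + a) (- c) (- b) ⟩
    (c + a) + (- c + - b)                         ≡⟨ cong ((c + a) +_) (-‿+-comm c b) ⟩
    (c + a) + - (c + b)                           ≡⟨ cong₂ (λ u v → u + - v) (mod-+ 1 m) (mod-+ 1 n) ⟨
    suc m mod p + - (suc n mod p)                 ∎
    where
    open ≡-Reasoning
    a b c : GF p
    a = m mod p
    b = n mod p
    c = 1 mod p

  fromℤ-+-homo : ∀ i j → fromℤ (i ℤ.+ j) ≡ fromℤ i + fromℤ j
  fromℤ-+-homo (ℤ.+ m)    (ℤ.+ n)    = mod-+ m n
  fromℤ-+-homo (ℤ.+ m)    ℤ.-[1+ n ] = fromℤ-⊖ m (suc n)
  fromℤ-+-homo ℤ.-[1+ m ] (ℤ.+ n)    = trans (fromℤ-⊖ n (suc m)) (+-comm _ _)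
  fromℤ-+-homo ℤ.-[1+ m ] ℤ.-[1+ n ] = begin
    - (suc (suc m ℕ.+ n) mod p)             ≡⟨ cong (λ k → - (suc k mod p)) (ℕ.+-suc m n) ⟨
    - ((suc m ℕ.+ suc n) mod p)             ≡⟨ cong -_ (mod-+ (suc m) (suc n)) ⟩
    - (suc m mod p + suc n mod p)           ≡⟨ -‿+-comm _ _ ⟨
    - (suc m mod p) + - (suc n mod p)       ∎
    where open ≡-Reasoning

  fromℤ-+*-homo : ∀ m j → fromℤ (ℤ.+ m ℤ.* j) ≡ m mod p * fromℤ j
  fromℤ-+*-homo m (ℤ.+ n)    = trans (cong fromℤ (sym (ℤ.pos-* m n))) (mod-* m n)
  fromℤ-+*-homo m ℤ.-[1+ n ] = begin
    fromℤ (ℤ.+ m ℤ.* ℤ.-[1+ n ])        ≡⟨ cong fromℤ (ℤ.neg-distribʳ-* (ℤ.+ m) ℤ.+[1+ n ]) ⟨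
    fromℤ (ℤ.- (ℤ.+ m ℤ.* ℤ.+[1+ n ]))  ≡⟨ fromℤ-‿homo (ℤ.+ m ℤ.* ℤ.+[1+ n ]) ⟩
    - fromℤ (ℤ.+ m ℤ.* ℤ.+[1+ n ])      ≡⟨ cong -_ (fromℤ-+*-homo m ℤ.+[1+ n ]) ⟩
    - (m mod p * (suc n mod p))         ≡⟨ -‿distribʳ-* _ _ ⟩
    m mod p * - (suc n mod p)           ∎
    where open ≡-Reasoning

  fromℤ-*-homo : ∀ i j → fromℤ (i ℤ.* j) ≡ fromℤ i * fromℤ j
  fromℤ-*-homo (ℤ.+ m)    j = fromℤ-+*-homo m j
  fromℤ-*-homo ℤ.-[1+ m ] j = begin
    fromℤ (ℤ.-[1+ m ] ℤ.* j)            ≡⟨ cong fromℤ (ℤ.neg-distribˡ-* ℤ.+[1+ m ] j) ⟨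
    fromℤ (ℤ.- (ℤ.+[1+ m ] ℤ.* j))      ≡⟨ fromℤ-‿homo (ℤ.+[1+ m ] ℤ.* j) ⟩
    - fromℤ (ℤ.+[1+ m ] ℤ.* j)          ≡⟨ cong -_ (fromℤ-+*-homo (suc m) j) ⟩
    - (suc m mod p * fromℤ j)           ≡⟨ -‿distribˡ-* _ _ ⟩
    - (suc m mod p) * fromℤ j           ∎
    where open ≡-Reasoning

  fromℤ-homomorphism : ℤ.+-*-rawRing ACR.-Raw-AlmostCommutative⟶ ACR.fromCommutativeRing GF-commutativeRing
  fromℤ-homomorphism = record
    { ⟦_⟧ = fromℤ ; +-homo = fromℤ-+-homo ; *-homo = fromℤ-*-homo ; -‿homo = fromℤ-‿homo
    ; 0-homo = refl ; 1-homo = refl }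

  fromℤ-≟ : ∀ i j → Maybe (fromℤ i ≡ fromℤ j)
  fromℤ-≟ i j = Maybe.map (cong fromℤ) (dec⇒maybe (i ℤ.≟ j))

  module GF-Solver = RingSolver ℤ.+-*-rawRing (ACR.fromCommutativeRing GF-commutativeRing) fromℤ-homomorphism fromℤ-≟

module _ {p : ℕ} {{_ : NonZero p}} where

  open Semiring-Sum (CommutativeRing.semiring (GF-commutativeRing {p})) public using (sum; sum-cong-≗; ∑-distrib-+; *-distribˡ-sum)
  open GF-Solver

  sumF≡sum : ∀ {m} (f : Fin m → GF p) → sumF f ≡ sum f
  sumF≡sum {zero}  f = refl
  sumF≡sum {suc m} f = trans (+F≡+ _ _) (cong (f Fin.zero +_) (sumF≡sum (f ∘ Fin.suc)))

  sum-zero : ∀ {m} (f : Fin m → GF p) → (∀ j → f j ≡ 0F) → sum f ≡ 0F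
  sum-zero {zero}  f f≡0 = refl
  sum-zero {suc m} f f≡0 = trans (cong₂ _+_ (f≡0 Fin.zero) (sum-zero (f ∘ Fin.suc) (f≡0 ∘ Fin.suc))) (+-identityˡ 0F)

  sum-single : ∀ {m} (f : Fin m → GF p) j₀ → (∀ j → j ≢ j₀ → f j ≡ 0F) → sum f ≡ f j₀
  sum-single f Fin.zero f≡0 =
    trans (cong (f Fin.zero +_) (sum-zero (f ∘ Fin.suc) (λ j → f≡0 (Fin.suc j) λ ()))) (+-identityʳ _)
  sum-single f (Fin.suc j₀) f≡0 =
    trans (cong₂ _+_ (f≡0 Fin.zero λ ()) (sum-single (f ∘ Fin.suc) j₀ (λ j j≢j₀ → f≡0 (Fin.suc j) (j≢j₀ ∘ Fin.suc-injective))))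
          (+-identityˡ _)

  δ : ∀ {m} → Fin m → Fin m → GF p
  δ i j = if does (i Fin.≟ j) then 1F else 0F

  δ-≡ : ∀ {m} (i : Fin m) → δ i i ≡ 1F
  δ-≡ i = if-≟-≡ i

  δ-≢ : ∀ {m} {i j : Fin m} → i ≢ j → δ i j ≡ 0F
  δ-≢ = if-≟-≢

  δ-injective : ∀ {k l} (f : Fin k → Fin l) → (∀ {u v} → f u ≡ f v → u ≡ v) → ∀ i j → δ (f i) (f j) ≡ δ i j
  δ-injective f f-inj i j = byCases (i Fin.≟ j)
    where
    byCases : Dec (i ≡ j) → δ (f i) (f j) ≡ δ i j
    byCases (yes refl) = trans (δ-≡ (f i)) (sym (δ-≡ i))
    byCases (no i≢j)   = trans (δ-≢ (i≢j ∘ f-inj)) (sym (δ-≢ i≢j))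

  if-≢0 : ∀ b {u v : GF p} → u ≢ 0F → v ≢ 0F → (if b then u else v) ≢ 0F
  if-≢0 true  u≢0 _   = u≢0
  if-≢0 false _   v≢0 = v≢0

  infix 4 ⟨_,_⟩

  ⟨_,_⟩ : ∀ {m} → (Fin m → GF p) → (Fin m → GF p) → GF p
  ⟨ u , v ⟩ = sum (λ j → u j * v j)

  ⟨⟩-linearˡ : ∀ {m} a b (u v w : Fin m → GF p) →
               ⟨ (λ j → a * u j + b * v j) , w ⟩ ≡ a * ⟨ u , w ⟩ + b * ⟨ v , w ⟩
  ⟨⟩-linearˡ a b u v w = begin
    sum (λ j → (a * u j + b * v j) * w j)             ≡⟨ sum-cong-≗ (λ j → solve 5 (λ a b u v w → (a :* u :+ b :* v) :* w := a :* (u :* w) :+ b :* (v :* w)) refl a b (u j) (v j) (w j)) ⟩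
    sum (λ j → a * (u j * w j) + b * (v j * w j))     ≡⟨ ∑-distrib-+ (λ j → a * (u j * w j)) (λ j → b * (v j * w j)) ⟩
    sum (λ j → a * (u j * w j)) + sum (λ j → b * (v j * w j)) ≡⟨ cong₂ _+_ (*-distribˡ-sum a (λ j → u j * w j)) (*-distribˡ-sum b (λ j → v j * w j)) ⟨
    a * ⟨ u , w ⟩ + b * ⟨ v , w ⟩                    ∎
    where open ≡-Reasoning

  ⟨⟩-comm : ∀ {m} (u v : Fin m → GF p) → ⟨ u , v ⟩ ≡ ⟨ v , u ⟩
  ⟨⟩-comm u v = sum-cong-≗ λ j → *-comm (u j) (v j)

  ⟨⟩-linearʳ : ∀ {m} a b (u v w : Fin m → GF p) →
               ⟨ u , (λ j → a * v j + b * w j) ⟩ ≡ a * ⟨ u , v ⟩ + b * ⟨ u , w ⟩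
  ⟨⟩-linearʳ a b u v w = begin
    ⟨ u , (λ j → a * v j + b * w j) ⟩  ≡⟨ ⟨⟩-comm u _ ⟩
    ⟨ (λ j → a * v j + b * w j) , u ⟩  ≡⟨ ⟨⟩-linearˡ a b v w u ⟩
    a * ⟨ v , u ⟩ + b * ⟨ w , u ⟩      ≡⟨ cong₂ (λ s t → a * s + b * t) (⟨⟩-comm v u) (⟨⟩-comm w u) ⟩
    a * ⟨ u , v ⟩ + b * ⟨ u , w ⟩      ∎
    where open ≡-Reasoning

  ⟨δ,v⟩≡v : ∀ {m} (i : Fin m) (w : Fin m → GF p) → ⟨ δ i , w ⟩ ≡ w i
  ⟨δ,v⟩≡v i w = trans (sum-single _ i λ j j≢i → trans (cong (_* w j) (δ-≢ (j≢i ∘ sym))) (zeroˡ (w j)))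
                   (trans (cong (_* w i) (δ-≡ i)) (*-identityˡ (w i)))

  ⟨⟩-cong-supp : ∀ {m} (u v w : Fin m → GF p) → (∀ j → u j ≡ 0F ⊎ v j ≡ w j) → ⟨ u , v ⟩ ≡ ⟨ u , w ⟩
  ⟨⟩-cong-supp u v w h = sum-cong-≗ λ j → term j (h j)
    where
    term : ∀ j → u j ≡ 0F ⊎ v j ≡ w j → u j * v j ≡ u j * w j
    term j (inj₁ uj≡0) rewrite uj≡0 = trans (zeroˡ (v j)) (sym (zeroˡ (w j)))
    term j (inj₂ vj≡wj) = cong (u j *_) vj≡wj

  sum-↑ : ∀ {k l} (f : Fin (k ℕ.+ l) → GF p) → sum f ≡ sum (f ∘ (_↑ˡ l)) + sum (f ∘ (k ↑ʳ_))
  sum-↑ {zero}  f = sym (+-identityˡ _)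
  sum-↑ {suc k} {l} f = trans (cong (f Fin.zero +_) (sum-↑ {k} {l} (f ∘ Fin.suc)))
    (sym (+-assoc (f Fin.zero) (sum (f ∘ Fin.suc ∘ (_↑ˡ l))) (sum (f ∘ Fin.suc ∘ (k ↑ʳ_)))))

  infixl 7 _·_

  _·_ : ∀ {r m} → Matrix {p} r m → (Fin m → GF p) → Fin r → GF p
  (A · c) x = ⟨ c , A x ⟩

  sumF≡· : ∀ {r m} (A : Matrix {p} r m) c x → sumF (λ j → c j *F A x j) ≡ (A · c) x
  sumF≡· A c x = trans (sumF≡sum (λ j → c j *F A x j)) (sum-cong-≗ λ j → *F≡* (c j) (A x j))

  SupportedOn : ∀ {m} → (Fin m → GF p) → Subset m → Set
  SupportedOn c J = ∀ j → j ∉ J → c j ≡ 0F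

  listSum : List (GF p) → GF p
  listSum = foldr _+_ 0F

  listSum-map-cong : ∀ {n} {f g : Fin n → GF p} {L} → All (λ j → f j ≡ g j) L → listSum (map f L) ≡ listSum (map g L)
  listSum-map-cong []         = refl
  listSum-map-cong (e ∷ eqs) = cong₂ _+_ e (listSum-map-cong eqs)

-- colB, colT, colC, Line and PrefixLines ignore p, so it must be passed explicitly.
module Columns {p : ℕ} {{_ : NonZero p}} {n : ℕ} where

  data Column : Fin (n ℕ.+ suc n) → Set where
    isB : ∀ i → Column (colB {p} i)
    isT : Column (colT {p})
    isC : ∀ i → Column (colC {p} i)

  column : ∀ col → Column col
  column col with splitAt n col | join-splitAt n (suc n) col
  ... | inj₁ i            | eq = subst Column eq (isB i)
  ... | inj₂ Fin.zero    | eq = subst Column eq isT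
  ... | inj₂ (Fin.suc i) | eq = subst Column eq (isC i)

  colB-injective : ∀ {i j} → colB {p} i ≡ colB {p} j → i ≡ j
  colB-injective = Fin.↑ˡ-injective (suc n) _ _

  colC-injective : ∀ {i j} → colC {p} i ≡ colC {p} j → i ≡ j
  colC-injective = Fin.suc-injective ∘ Fin.↑ʳ-injective n _ _

  colB≢colT : ∀ {i} → colB {p} i ≢ colT {p}
  colB≢colT {i} eq with trans (sym (splitAt-↑ˡ n i (suc n))) (trans (cong (splitAt n) eq) (splitAt-↑ʳ n (suc n) Fin.zero))
  ... | ()

  colB≢colC : ∀ {i j} → colB {p} i ≢ colC {p} j
  colB≢colC {i} {j} eq with trans (sym (splitAt-↑ˡ n i (suc n))) (trans (cong (splitAt n) eq) (splitAt-↑ʳ n (suc n) (Fin.suc j)))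
  ... | ()

  colT≢colC : ∀ {j} → colT {p} ≢ colC {p} j
  colT≢colC {j} eq with trans (sym (splitAt-↑ʳ n (suc n) Fin.zero)) (trans (cong (splitAt n) eq) (splitAt-↑ʳ n (suc n) (Fin.suc j)))
  ... | ()

  byColumn : ∀ {a} {A : Set a} → (Fin n → A) → A → (Fin n → A) → Fin (n ℕ.+ suc n) → A
  byColumn fB fT fC col with splitAt n col
  ... | inj₁ j            = fB j
  ... | inj₂ Fin.zero    = fT
  ... | inj₂ (Fin.suc j) = fC j

  module _ {a} {A : Set a} (fB : Fin n → A) (fT : A) (fC : Fin n → A) where

    byColumn-colB : ∀ j → byColumn fB fT fC (colB {p} j) ≡ fB j
    byColumn-colB j rewrite splitAt-↑ˡ n j (suc n) = refl

    byColumn-colT : byColumn fB fT fC (colT {p}) ≡ fT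
    byColumn-colT rewrite splitAt-↑ʳ n (suc n) (Fin.zero {n}) = refl

    byColumn-colC : ∀ j → byColumn fB fT fC (colC {p} j) ≡ fC j
    byColumn-colC j rewrite splitAt-↑ʳ n (suc n) (Fin.suc j) = refl

  module _ (x : Fin n → GF p) (r : Fin n) where

    ssr-colB : ∀ i → ssr x r (colB {p} i) ≡ δ i r
    ssr-colB i rewrite splitAt-↑ˡ n i (suc n) with i Fin.≟ r
    ... | yes _ = refl
    ... | no _  = refl

    ssr-colT : ssr x r (colT {p}) ≡ 1F
    ssr-colT rewrite splitAt-↑ʳ n (suc n) (Fin.zero {n}) = refl

    ssr-colC : ∀ i → ssr x r (colC {p} i) ≡ 1F + x i * δ i r
    ssr-colC i rewrite splitAt-↑ʳ n (suc n) (Fin.suc i) with i Fin.≟ r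
    ... | yes _ = trans (+F≡+ 1F (x i)) (cong (1F +_) (sym (*-identityʳ (x i))))
    ... | no _  = sym (trans (cong (1F +_) (zeroʳ (x i))) (+-identityʳ 1F))

  ∈Line⁻ : ∀ {i : Fin n} {col} → col ∈ Line {p} i → col ≡ colB {p} i ⊎ col ≡ colT {p} ⊎ col ≡ colC {p} i
  ∈Line⁻ {i} col∈ with x∈p∪q⁻ (⁅ colB {p} i ⁆ ∪ ⁅ colT {p} ⁆) ⁅ colC {p} i ⁆ col∈
  ... | inj₂ col∈C = inj₂ (inj₂ (x∈⁅y⁆⇒x≡y _ col∈C))
  ... | inj₁ col∈BT with x∈p∪q⁻ ⁅ colB {p} i ⁆ ⁅ colT {p} ⁆ col∈BT
  ...   | inj₁ col∈B = inj₁ (x∈⁅y⁆⇒x≡y _ col∈B)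
  ...   | inj₂ col∈T = inj₂ (inj₁ (x∈⁅y⁆⇒x≡y _ col∈T))

  colB∈Line : ∀ (i : Fin n) → colB {p} i ∈ Line {p} i
  colB∈Line i = x∈p∪q⁺ (inj₁ (x∈p∪q⁺ (inj₁ (x∈⁅x⁆ _))))

  colT∈Line : ∀ (i : Fin n) → colT {p} ∈ Line {p} i
  colT∈Line i = x∈p∪q⁺ (inj₁ (x∈p∪q⁺ (inj₂ (x∈⁅x⁆ _))))

  ∈PrefixLines⁻ : ∀ {k col} → col ∈ PrefixLines {p} n k → ∃ λ i → toℕ i < k × col ∈ Line {p} i
  ∈PrefixLines⁻ {k} col∈ with find (Any.map⁻ (x∈⋃⁻ _ col∈))
  ... | i , i∈ , col∈Line = i , proj₂ (∈-filter⁻ (λ i → toℕ i ℕ.<? k) {xs = allFin n} i∈) , col∈Line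

  Line⊆PrefixLines : ∀ {k} {i : Fin n} → toℕ i < k → Line {p} i ⊆ PrefixLines {p} n k
  Line⊆PrefixLines {k} {i} i<k col∈ =
    x∈⋃⁺ (Any.map⁺ (lose (∈-filter⁺ (λ i → toℕ i ℕ.<? k) (∈-allFin i) i<k) col∈))

  module _ (x : Fin n → GF p) where

    ssr-rows-agree : ∀ {i y y′ : Fin n} {col} → i ≢ y → i ≢ y′ → col ∈ Line {p} i → ssr x y col ≡ ssr x y′ col
    ssr-rows-agree {i} {y} {y′} {col} i≢y i≢y′ col∈ = onLine (∈Line⁻ col∈)
      where
      δ-agree : δ i y ≡ δ i y′
      δ-agree = trans (δ-≢ i≢y) (sym (δ-≢ i≢y′))
      onLine : col ≡ colB {p} i ⊎ col ≡ colT {p} ⊎ col ≡ colC {p} i → ssr x y col ≡ ssr x y′ col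
      onLine (inj₁ refl)        = trans (ssr-colB x y i) (trans δ-agree (sym (ssr-colB x y′ i)))
      onLine (inj₂ (inj₁ refl)) = trans (ssr-colT x y) (sym (ssr-colT x y′))
      onLine (inj₂ (inj₂ refl)) = trans (ssr-colC x y i) (trans (cong (λ d → 1F + x i * d) δ-agree) (sym (ssr-colC x y′ i)))

  ssr·-offC : ∀ (x : Fin n → GF p) (c : Fin (n ℕ.+ suc n) → GF p) → (∀ i → c (colC {p} i) ≡ 0F) →
              ∀ r → (ssr x · c) r ≡ c (colB {p} r) + c (colT {p})
  ssr·-offC x c c≡0 r = begin
    (ssr x · c) r                                                          ≡⟨ sum-↑ (λ j → c j * ssr x r j) ⟩
    sum (λ i → c (colB {p} i) * ssr x r (colB {p} i)) +
      (c (colT {p}) * ssr x r (colT {p}) + sum (λ i → c (colC {p} i) * ssr x r (colC {p} i)))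
                                                                           ≡⟨ cong₂ _+_ bPart (cong₂ _+_ tPart cPart) ⟩
    c (colB {p} r) + (c (colT {p}) + 0F)                                   ≡⟨ cong (c (colB {p} r) +_) (+-identityʳ _) ⟩
    c (colB {p} r) + c (colT {p})                                          ∎
    where
    open ≡-Reasoning
    bPart : sum (λ i → c (colB {p} i) * ssr x r (colB {p} i)) ≡ c (colB {p} r)
    bPart = begin
      sum (λ i → c (colB {p} i) * ssr x r (colB {p} i))  ≡⟨ sum-cong-≗ (λ i → cong (c (colB {p} i) *_) (ssr-colB x r i)) ⟩
      sum (λ i → c (colB {p} i) * δ i r)                 ≡⟨ sum-single _ r (λ i i≢r → trans (cong (c (colB {p} i) *_) (δ-≢ i≢r)) (zeroʳ _)) ⟩
      c (colB {p} r) * δ r r                             ≡⟨ cong (c (colB {p} r) *_) (δ-≡ r) ⟩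
      c (colB {p} r) * 1F                                ≡⟨ *-identityʳ _ ⟩
      c (colB {p} r)                                     ∎
    tPart : c (colT {p}) * ssr x r (colT {p}) ≡ c (colT {p})
    tPart = trans (cong (c (colT {p}) *_) (ssr-colT x r)) (*-identityʳ _)
    cPart : sum (λ i → c (colC {p} i) * ssr x r (colC {p} i)) ≡ 0F
    cPart = sum-zero _ λ i → trans (cong (_* ssr x r (colC {p} i)) (c≡0 i)) (zeroˡ _)

module Swap {p : ℕ} {{_ : NonZero p}} where

  swapIdx-left : ∀ {k} (a b : Fin k) → swapIdx {p} a b a ≡ b
  swapIdx-left a b with a Fin.≟ a
  ... | yes _   = refl
  ... | no a≢a = contradiction refl a≢a

  swapIdx-right : ∀ {k} (a b : Fin k) → swapIdx {p} a b b ≡ a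
  swapIdx-right a b with b Fin.≟ a
  ... | yes b≡a = b≡a
  ... | no _ with b Fin.≟ b
  ...   | yes _   = refl
  ...   | no b≢b = contradiction refl b≢b

  swapIdx-other : ∀ {k} {a b c : Fin k} → c ≢ a → c ≢ b → swapIdx {p} a b c ≡ c
  swapIdx-other {a = a} {b} {c} c≢a c≢b with c Fin.≟ a
  ... | yes c≡a = contradiction c≡a c≢a
  ... | no _ with c Fin.≟ b
  ...   | yes c≡b = contradiction c≡b c≢b
  ...   | no _    = refl

  swapIdx-involutive : ∀ {k} (a b c : Fin k) → swapIdx {p} a b (swapIdx {p} a b c) ≡ c
  swapIdx-involutive a b c with c Fin.≟ a
  ... | yes refl = swapIdx-right c b
  ... | no c≢a with c Fin.≟ b
  ...   | yes refl = swapIdx-left a c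
  ...   | no c≢b   = swapIdx-other c≢a c≢b

  swapIdx-injective : ∀ {k} (a b : Fin k) {c d} → swapIdx {p} a b c ≡ swapIdx {p} a b d → c ≡ d
  swapIdx-injective a b {c} {d} eq =
    trans (sym (swapIdx-involutive a b c)) (trans (cong (swapIdx {p} a b) eq) (swapIdx-involutive a b d))

  swapIdx-natural : ∀ {k l} (f : Fin k → Fin l) → (∀ {u v} → f u ≡ f v → u ≡ v) →
                    ∀ a b c → swapIdx {p} (f a) (f b) (f c) ≡ f (swapIdx {p} a b c)
  swapIdx-natural f f-inj a b c with c Fin.≟ a
  ... | yes refl = swapIdx-left (f c) (f b)
  ... | no c≢a with c Fin.≟ b
  ...   | yes refl = swapIdx-right (f a) (f c)
  ...   | no c≢b   = swapIdx-other (c≢a ∘ f-inj) (c≢b ∘ f-inj)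

module _ {p : ℕ} {{_ : NonZero p}} {r m : ℕ} where

  id-isFieldAutomorphism : IsFieldAutomorphism {p} id
  id-isFieldAutomorphism = record
    { injective = λ _ _ → id ; surjective = λ b → b , refl
    ; pres-+ = λ _ _ → refl ; pres-* = λ _ _ → refl ; pres-1 = refl }

  ≗⇒weakEquiv : {A B : Matrix {p} r m} → (∀ x y → A x y ≡ B x y) → WeakEquiv A B
  ≗⇒weakEquiv A≗B = fieldAut id id-isFieldAutomorphism (λ x y → sym (A≗B x y)) ◅ ε

  weakEquiv-respʳ : {A B C : Matrix {p} r m} → WeakEquiv A B → (∀ x y → B x y ≡ C x y) → WeakEquiv A C
  weakEquiv-respʳ A~B B≗C = A~B ◅◅ ≗⇒weakEquiv B≗C

  -- slice x y is the row or the column of an entry; T is reached from A one slice at a time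
  module _ {l : ℕ} (slice : Fin r → Fin m → Fin l) (A T : Matrix {p} r m) where

    mix : ℕ → Matrix {p} r m
    mix k x y with toℕ (slice x y) ℕ.<? k
    ... | yes _ = T x y
    ... | no _  = A x y

    mix-A-or-T : ∀ k x y → mix k x y ≡ A x y ⊎ mix k x y ≡ T x y
    mix-A-or-T k x y with toℕ (slice x y) ℕ.<? k
    ... | yes _ = inj₂ refl
    ... | no _  = inj₁ refl

    mix-< : ∀ {k x y} → toℕ (slice x y) < k → mix k x y ≡ T x y
    mix-< {k} {x} {y} lt with toℕ (slice x y) ℕ.<? k
    ... | yes _  = refl
    ... | no ≮k = contradiction lt ≮k

    mix-≮ : ∀ {k x y} → ¬ toℕ (slice x y) < k → mix k x y ≡ A x y
    mix-≮ {k} {x} {y} ≮k with toℕ (slice x y) ℕ.<? k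
    ... | yes lt = contradiction lt ≮k
    ... | no _   = refl

    mix-suc : ∀ {k x y} → toℕ (slice x y) ≢ k → mix (suc k) x y ≡ mix k x y
    mix-suc {k} {x} {y} ≢k with toℕ (slice x y) ℕ.<? k
    ... | yes lt = mix-< (ℕ.m<n⇒m<1+n lt)
    ... | no ≮k  = mix-≮ λ lt → ≮k (ℕ.≤∧≢⇒< (ℕ.≤-pred lt) ≢k)

    SliceStep : Set
    SliceStep = ∀ s (M N : Matrix {p} r m) →
      (∀ x y → M x y ≡ A x y ⊎ M x y ≡ T x y) →
      (∀ x y → slice x y ≡ s → M x y ≡ A x y) →
      (∀ x y → slice x y ≡ s → N x y ≡ T x y) →
      (∀ x y → slice x y ≢ s → N x y ≡ M x y) →
      WeakEquiv M N

    sliceBySlice : SliceStep → WeakEquiv A T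
    sliceBySlice step = weakEquiv-respʳ (upTo l ℕ.≤-refl) (λ x y → mix-< (toℕ<n (slice x y)))
      where
      upTo : ∀ k → k ≤ l → WeakEquiv A (mix k)
      upTo zero    _   = ≗⇒weakEquiv λ x y → sym (mix-≮ {0} λ ())
      upTo (suc k) k<l = upTo k (ℕ.<⇒≤ k<l) ◅◅ step s (mix k) (mix (suc k)) (mix-A-or-T k)
        (λ x y eq → mix-≮ (ℕ.<-irrefl (at eq)))
        (λ x y eq → mix-< (ℕ.≤-reflexive (cong suc (at eq))))
        (λ x y ne → mix-suc (ne ∘ λ eq → toℕ-injective (trans eq (sym (toℕ-fromℕ< k<l)))))
        where
        s = fromℕ< k<l
        at : ∀ {x y} → slice x y ≡ s → toℕ (slice x y) ≡ k
        at eq = trans (cong toℕ eq) (toℕ-fromℕ< k<l)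

  scaleRows : (A : Matrix {p} r m) (ℓ : Fin r → GF p) → (∀ x → ℓ x ≢ 0F) →
              WeakEquiv A (λ x y → ℓ x * A x y)
  scaleRows A ℓ ℓ≢0 = sliceBySlice (λ x _ → x) A _ λ s M N _ M≡A N≡T N≡M →
    rowScale s (ℓ s) (ℓ≢0 s)
      (λ y → trans (N≡T s y refl) (trans (sym (*F≡* _ _)) (cong (ℓ s *F_) (sym (M≡A s y refl)))))
      N≡M
    ◅ ε

  scaleCols : (A : Matrix {p} r m) (μ : Fin m → GF p) → (∀ y → μ y ≢ 0F) →
              WeakEquiv A (λ x y → μ y * A x y)
  scaleCols A μ μ≢0 = sliceBySlice (λ _ y → y) A _ λ s M N _ M≡A N≡T N≡M →
    colScale s (μ s) (μ≢0 s)
      (λ x → trans (N≡T x s refl) (trans (sym (*F≡* _ _)) (cong (μ s *F_) (sym (M≡A x s refl)))))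
      N≡M
    ◅ ε

  addRowToOthers : (A : Matrix {p} r m) (i : Fin r) →
                   WeakEquiv A (λ x y → if does (x Fin.≟ i) then A x y else A x y + A i y)
  addRowToOthers A i = sliceBySlice (λ x _ → x) A T step
    where
    T : Matrix {p} r m
    T x y = if does (x Fin.≟ i) then A x y else A x y + A i y
    step : SliceStep (λ x _ → x) A T
    step s M N M≡A⊎T M≡A N≡T N≡M with s Fin.≟ i
    ... | yes refl = ≗⇒weakEquiv unchanged
      where
      unchanged : ∀ x y → M x y ≡ N x y
      unchanged x y with x Fin.≟ s
      ... | yes refl = trans (M≡A x y refl) (sym (trans (N≡T x y refl) (if-≟-≡ x)))
      ... | no x≢s   = sym (N≡M x y x≢s)
    ... | no s≢i = rowAdd s i s≢i added N≡M ◅ ε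
      where
      Mi≡Ai : ∀ y → M i y ≡ A i y
      Mi≡Ai y = [ id , (λ Mi≡Ti → trans Mi≡Ti (if-≟-≡ i)) ]′ (M≡A⊎T i y)
      added : ∀ y → N s y ≡ M s y +F M i y
      added y = begin
        N s y                ≡⟨ N≡T s y refl ⟩
        T s y                ≡⟨ if-≟-≢ s≢i ⟩
        A s y + A i y        ≡⟨ cong₂ _+_ (M≡A s y refl) (Mi≡Ai y) ⟨
        M s y + M i y        ≡⟨ +F≡+ _ _ ⟨
        M s y +F M i y       ∎
        where open ≡-Reasoning

-- GF(p) is a field

module _ {p : ℕ} {{_ : NonZero p}} (p-prime : Prime p) where

  open Columns {p = p}
  open Swap {p = p}

  open GF-Solver

  1<p : 1 < p
  1<p = ℕ.nonTrivial⇒n>1 p {{prime⇒nonTrivial p-prime}}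

  toℕ-1F : toℕ (1F {p}) ≡ 1
  toℕ-1F = trans (toℕ-mod 1) (m<n⇒m%n≡m 1<p)

  toℕ-0F : toℕ (0F {p}) ≡ 0
  toℕ-0F = trans (toℕ-mod 0) (m*n%n≡0 0 p)

  1F≢0F : 1F {p} ≢ 0F
  1F≢0F 1≡0 = ℕ.1+n≢0 (trans (sym toℕ-1F) (trans (cong toℕ 1≡0) toℕ-0F))

  -1F≡-1F : -1F {p} ≡ - 1F
  -1F≡-1F = trans (cong (λ k → (p ∸ k) mod p) (sym toℕ-1F)) (sym (-‿toℕ 1F))

  mod-≡ : ∀ {m n} → m % p ≡ n % p → m mod p ≡ n mod p
  mod-≡ eq = toℕ-injective (trans (toℕ-mod _) (trans eq (sym (toℕ-mod _))))

  *-inverse-exists : ∀ a → a ≢ 0F → ∃ λ b → a * b ≡ 1F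
  *-inverse-exists a a≢0 = fromBézout (coprime-Bézout (prime⇒coprime p-prime {{k≢0}} (toℕ<n a)))
    where
    open ≡-Reasoning
    k : ℕ
    k = toℕ a
    k≢0 : NonZero k
    k≢0 = ℕ.≢-nonZero λ k≡0 → a≢0 (toℕ-injective (trans k≡0 (sym toℕ-0F)))
    a*y : ∀ y → a * (y mod p) ≡ (k ℕ.* y) mod p
    a*y y = trans (cong (_* (y mod p)) (sym (mod-toℕ a))) (sym (mod-* k y))
    fromBézout : Bézout.Identity 1 p k → ∃ λ b → a * b ≡ 1F
    fromBézout (Bézout.-+ x y eq) = y mod p , (begin
      a * (y mod p)         ≡⟨ a*y y ⟩
      (k ℕ.* y) mod p       ≡⟨ cong (_mod p) (trans (ℕ.*-comm k y) (sym eq)) ⟩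
      (1 ℕ.+ x ℕ.* p) mod p ≡⟨ mod-≡ ([m+kn]%n≡m%n 1 x p) ⟩
      1F                    ∎)
    fromBézout (Bézout.+- x y eq) = - (y mod p) , (begin
      a * - (y mod p)       ≡⟨ -‿distribʳ-* a (y mod p) ⟨
      - (a * (y mod p))     ≡⟨ cong -_ (+-inverseʳ-unique 1F _ 1+ay≡0) ⟩
      - - 1F                ≡⟨ -‿involutive 1F ⟩
      1F                    ∎)
      where
      1+ay≡0 : 1F + a * (y mod p) ≡ 0F
      1+ay≡0 = begin
        1F + a * (y mod p)          ≡⟨ cong (1F +_) (a*y y) ⟩
        1F + (k ℕ.* y) mod p        ≡⟨ mod-+ 1 (k ℕ.* y) ⟨
        (1 ℕ.+ k ℕ.* y) mod p       ≡⟨ cong (λ z → (1 ℕ.+ z) mod p) (ℕ.*-comm k y) ⟩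
        (1 ℕ.+ y ℕ.* k) mod p       ≡⟨ cong (_mod p) eq ⟩
        (x ℕ.* p) mod p             ≡⟨ mod-≡ (trans (m*n%n≡0 x p) (sym (m*n%n≡0 0 p))) ⟩
        0F                          ∎

  -- 0F ⁻¹ = 0F is a junk value
  _⁻¹ : GF p → GF p
  a ⁻¹ with a Fin.≟ 0F
  ... | yes _   = 0F
  ... | no a≢0 = proj₁ (*-inverse-exists a a≢0)

  *-inverseʳ : ∀ {a} → a ≢ 0F → a * a ⁻¹ ≡ 1F
  *-inverseʳ {a} a≢0 with a Fin.≟ 0F
  ... | yes a≡0 = contradiction a≡0 a≢0
  ... | no a≢0  = proj₂ (*-inverse-exists a a≢0)

  *-inverseˡ : ∀ {a} → a ≢ 0F → a ⁻¹ * a ≡ 1F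
  *-inverseˡ {a} a≢0 = trans (*-comm (a ⁻¹) a) (*-inverseʳ a≢0)

  *-cancelˡ : ∀ {a} b c → a ≢ 0F → a * b ≡ a * c → b ≡ c
  *-cancelˡ {a} b c a≢0 ab≡ac = begin
    b                ≡⟨ *-identityˡ b ⟨
    1F * b           ≡⟨ cong (_* b) (*-inverseˡ a≢0) ⟨
    a ⁻¹ * a * b     ≡⟨ *-assoc (a ⁻¹) a b ⟩
    a ⁻¹ * (a * b)   ≡⟨ cong (a ⁻¹ *_) ab≡ac ⟩
    a ⁻¹ * (a * c)   ≡⟨ *-assoc (a ⁻¹) a c ⟨
    a ⁻¹ * a * c     ≡⟨ cong (_* c) (*-inverseˡ a≢0) ⟩
    1F * c           ≡⟨ *-identityˡ c ⟩
    c                ∎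
    where open ≡-Reasoning

  *-≢0 : ∀ {a b} → a ≢ 0F → b ≢ 0F → a * b ≢ 0F
  *-≢0 {a} {b} a≢0 b≢0 ab≡0 = b≢0 (*-cancelˡ b 0F a≢0 (trans ab≡0 (sym (zeroʳ a))))

  ⁻¹-≢0 : ∀ {a} → a ≢ 0F → a ⁻¹ ≢ 0F
  ⁻¹-≢0 {a} a≢0 a⁻¹≡0 = 1F≢0F (trans (sym (*-inverseʳ a≢0)) (trans (cong (a *_) a⁻¹≡0) (zeroʳ a)))

  -‿≢0 : ∀ {a : GF p} → a ≢ 0F → - a ≢ 0F
  -‿≢0 {a} a≢0 -a≡0 = a≢0 (trans (sym (-‿involutive a)) (trans (cong -_ -a≡0) -0#≈0#))

  -- Rank

  KernelWitness : ∀ {r m} → Matrix {p} r m → Subset r → Subset m → Set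
  KernelWitness C R J = ∃ λ c → SupportedOn c J × (∀ x → x ∈ R → (C · c) x ≡ 0F) × ∃ λ j → c j ≢ 0F

  kernelWitness-noRows : ∀ {r m} (C : Matrix {p} r m) {R J} → ∣ R ∣ ≡ 0 → 0 < ∣ J ∣ → KernelWitness C R J
  kernelWitness-noRows C {R} {J} ∣R∣≡0 0<∣J∣ with 0<∣p∣⇒nonempty J 0<∣J∣
  ... | j₀ , j₀∈J = δ j₀ , supported , noRow , j₀ , subst (_≢ 0F) (sym (δ-≡ j₀)) 1F≢0F
    where
    supported : SupportedOn (δ j₀) J
    supported j j∉J = δ-≢ λ j₀≡j → j∉J (subst (_∈ J) j₀≡j j₀∈J)
    noRow : ∀ x → x ∈ R → (C · δ j₀) x ≡ 0F
    noRow x x∈R = contradiction (subst (∣ R Sub.- x ∣ <_) ∣R∣≡0 (x∈p⇒∣p-x∣<∣p∣ x∈R)) λ ()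

  kernelWitness-zeroRow : ∀ {r m} (C : Matrix {p} r m) {R J x₀} → (∀ {j} → j ∈ J → C x₀ j ≡ 0F) →
                          KernelWitness C (R Sub.- x₀) J → KernelWitness C R J
  kernelWitness-zeroRow C {R} {J} {x₀} zeroOnJ (c , supported , annihilated , nonzero) =
    c , supported , annihilated′ , nonzero
    where
    vanishes : ∀ j → c j * C x₀ j ≡ 0F
    vanishes j with j ∈? J
    ... | yes j∈J = trans (cong (c j *_) (zeroOnJ j∈J)) (zeroʳ (c j))
    ... | no j∉J  = trans (cong (_* C x₀ j) (supported j j∉J)) (zeroˡ _)
    annihilated′ : ∀ x → x ∈ R → (C · c) x ≡ 0F
    annihilated′ x x∈R with x Fin.≟ x₀
    ... | yes refl = sum-zero _ vanishes
    ... | no x≢x₀  = annihilated x (x∈p∧x≢y⇒x∈p-y x∈R x≢x₀)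

  clearColumn : ∀ {r m} → Matrix {p} r m → Fin r → Fin m → Matrix {p} r m
  clearColumn C x₀ j₀ x j = C x₀ j₀ * C x j + - C x j₀ * C x₀ j

  kernelWitness-pivot : ∀ {r m} (C : Matrix {p} r m) {R J x₀ j₀} → j₀ ∈ J → C x₀ j₀ ≢ 0F →
                        KernelWitness (clearColumn C x₀ j₀) (R Sub.- x₀) (J Sub.- j₀) → KernelWitness C R J
  kernelWitness-pivot C {R} {J} {x₀} {j₀} j₀∈J α≢0 (c′ , supported′ , annihilated′ , j₁ , c′j₁≢0) =
    c , supported , annihilated , j₁ , cj₁≢0
    where
    open ≡-Reasoning
    α S₀ : GF p
    α = C x₀ j₀
    S₀ = (C · c′) x₀
    c : Fin _ → GF p
    c j = α * c′ j + - S₀ * δ j₀ j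
    C·c : ∀ x → (C · c) x ≡ α * (C · c′) x + - S₀ * C x j₀
    C·c x = trans (⟨⟩-linearˡ α (- S₀) c′ (δ j₀) (C x)) (cong (λ z → α * (C · c′) x + - S₀ * z) (⟨δ,v⟩≡v j₀ (C x)))
    annihilated : ∀ x → x ∈ R → (C · c) x ≡ 0F
    annihilated x x∈R with x Fin.≟ x₀
    ... | yes refl = trans (C·c x) (solve 2 (λ a s → a :* s :+ (:- s) :* a := con ℤ.0ℤ) refl α S₀)
    ... | no x≢x₀  = begin
      (C · c) x                                ≡⟨ C·c x ⟩
      α * (C · c′) x + - S₀ * C x j₀           ≡⟨ solve 4 (λ a t s b → a :* t :+ (:- s) :* b := a :* t :+ (:- b) :* s) refl α ((C · c′) x) S₀ (C x j₀) ⟩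
      α * (C · c′) x + - C x j₀ * S₀           ≡⟨ ⟨⟩-linearʳ α (- C x j₀) c′ (C x) (C x₀) ⟨
      (clearColumn C x₀ j₀ · c′) x             ≡⟨ annihilated′ x (x∈p∧x≢y⇒x∈p-y x∈R x≢x₀) ⟩
      0F                                       ∎
    supported : SupportedOn c J
    supported j j∉J = begin
      α * c′ j + - S₀ * δ j₀ j   ≡⟨ cong₂ (λ u v → α * u + - S₀ * v) (supported′ j (j∉J ∘ p─q⊆p J _)) (δ-≢ λ j₀≡j → j∉J (subst (_∈ J) j₀≡j j₀∈J)) ⟩
      α * 0F + - S₀ * 0F         ≡⟨ solve 2 (λ a s → a :* con ℤ.0ℤ :+ (:- s) :* con ℤ.0ℤ := con ℤ.0ℤ) refl α S₀ ⟩
      0F                         ∎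
    j₀≢j₁ : j₀ ≢ j₁
    j₀≢j₁ j₀≡j₁ = c′j₁≢0 (supported′ j₁ (subst (_∉ J Sub.- j₀) j₀≡j₁ (x∉p-x J j₀)))
    cj₁≢0 : c j₁ ≢ 0F
    cj₁≢0 = subst (_≢ 0F) (sym cj₁≡αc′j₁) (*-≢0 α≢0 c′j₁≢0)
      where
      cj₁≡αc′j₁ : c j₁ ≡ α * c′ j₁
      cj₁≡αc′j₁ = trans (cong (λ v → α * c′ j₁ + - S₀ * v) (δ-≢ j₀≢j₁))
                        (solve 2 (λ u s → u :+ (:- s) :* con ℤ.0ℤ := u) refl (α * c′ j₁) S₀)

  -- Gaussian elimination: each step removes one row from R and at most one column from J
  kernelWitness : ∀ {r m} (C : Matrix {p} r m) R J → ∣ R ∣ < ∣ J ∣ → KernelWitness C R J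
  kernelWitness C R J = go _ C R J refl
    where
    go : ∀ {r m} k (C : Matrix {p} r m) R J → ∣ R ∣ ≡ k → k < ∣ J ∣ → KernelWitness C R J
    go zero    C R J ∣R∣≡0   0<∣J∣   = kernelWitness-noRows C ∣R∣≡0 0<∣J∣
    go (suc k) C R J ∣R∣≡1+k 1+k<∣J∣ with 0<∣p∣⇒nonempty R (subst (0 <_) (sym ∣R∣≡1+k) (s≤s z≤n))
    ... | x₀ , x₀∈R with any? (λ j → (j ∈? J) ×-dec ¬? (C x₀ j Fin.≟ 0F))
    ...   | yes (j₀ , j₀∈J , pivot) = kernelWitness-pivot C j₀∈J pivot
            (go k _ (R Sub.- x₀) (J Sub.- j₀) ∣R-x₀∣≡k (ℕ.s<s⁻¹ (subst (suc k <_) (sym (∣p-x∣+1≡∣p∣ j₀∈J)) 1+k<∣J∣)))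
      where
      ∣R-x₀∣≡k : ∣ R Sub.- x₀ ∣ ≡ k
      ∣R-x₀∣≡k = ℕ.suc-injective (trans (∣p-x∣+1≡∣p∣ x₀∈R) ∣R∣≡1+k)
    ...   | no noPivot = kernelWitness-zeroRow C zeroOnJ (go k C (R Sub.- x₀) J ∣R-x₀∣≡k (ℕ.<-trans (ℕ.n<1+n k) 1+k<∣J∣))
      where
      ∣R-x₀∣≡k : ∣ R Sub.- x₀ ∣ ≡ k
      ∣R-x₀∣≡k = ℕ.suc-injective (trans (∣p-x∣+1≡∣p∣ x₀∈R) ∣R∣≡1+k)
      zeroOnJ : ∀ {j} → j ∈ J → C x₀ j ≡ 0F
      zeroOnJ {j} j∈J with C x₀ j Fin.≟ 0F
      ... | yes C≡0 = C≡0
      ... | no C≢0  = contradiction (j , j∈J , C≢0) noPivot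

  card-independent≤ : ∀ {r m} (A : Matrix {p} r m) {S : Subset m} (R : Subset r) →
    (∀ x → ∃ λ y → y ∈ R × ∀ {j} → j ∈ S → A x j ≡ A y j) →
    ∀ {J} → J ⊆ S → Independent A J → ∣ J ∣ ≤ ∣ R ∣
  card-independent≤ A R spans {J} J⊆S J-indep with ∣ R ∣ ℕ.<? ∣ J ∣
  ... | no ∣R∣≮∣J∣ = ℕ.≮⇒≥ ∣R∣≮∣J∣
  ... | yes ∣R∣<∣J∣ with kernelWitness A R J ∣R∣<∣J∣
  ...   | c , supported , annihilated , j , cj≢0 =
    contradiction (J-indep c supported (λ x → trans (sumF≡· A c x) (rowZero x)) j) cj≢0
    where
    rowZero : ∀ x → (A · c) x ≡ 0F
    rowZero x with spans x
    ... | y , y∈R , agree = trans (⟨⟩-cong-supp c (A x) (A y) onJ) (annihilated y y∈R)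
      where
      onJ : ∀ j → c j ≡ 0F ⊎ A x j ≡ A y j
      onJ j with j ∈? J
      ... | yes j∈J = inj₂ (agree (J⊆S j∈J))
      ... | no j∉J  = inj₁ (supported j j∉J)

  -- [I | 1 | B] represents a spike

  module _ {n : ℕ} (x : Fin n → GF p) where

    colC∉basis : ∀ {K : Subset n} {s} {i : Fin n} → colC {p} i ∉ K ++ (s ∷ Sub.⊥)
    colC∉basis {K} {s} {i} col∈ with ∈-++ʳ⁻ {p = K} {q = s ∷ Sub.⊥} {j = Fin.suc i} col∈
    ... | there i∈⊥ = ∉⊥ i∈⊥

    ssr-kernel-basis : ∀ K s (c : Fin (n ℕ.+ suc n) → GF p) → SupportedOn c (K ++ (s ∷ Sub.⊥)) →
                       (∀ r → (ssr x · c) r ≡ 0F) → c (colT {p}) ≡ 0F → ∀ j → c j ≡ 0F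
    ssr-kernel-basis K s c supported c∈ker cT≡0 j with column {n = n} j
    ... | isB i = begin
      c (colB {p} i)                     ≡⟨ +-identityʳ _ ⟨
      c (colB {p} i) + 0F                ≡⟨ cong (c (colB {p} i) +_) cT≡0 ⟨
      c (colB {p} i) + c (colT {p})      ≡⟨ ssr·-offC x c (λ i → supported _ colC∉basis) i ⟨
      (ssr x · c) i                      ≡⟨ c∈ker i ⟩
      0F                                 ∎
      where open ≡-Reasoning
    ... | isT   = cT≡0
    ... | isC i = supported _ colC∉basis

    independent-withTip : ∀ {K r₀} → r₀ ∉ K → Independent (ssr x) (K ++ (inside ∷ Sub.⊥))
    independent-withTip {K} {r₀} r₀∉K c supported kernel = ssr-kernel-basis K inside c supported c∈ker cT≡0
      where
      c∈ker : ∀ r → (ssr x · c) r ≡ 0F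
      c∈ker r = trans (sym (sumF≡· (ssr x) c r)) (kernel r)
      cT≡0 : c (colT {p}) ≡ 0F
      cT≡0 = begin
        c (colT {p})                       ≡⟨ +-identityˡ _ ⟨
        0F + c (colT {p})                  ≡⟨ cong (_+ c (colT {p})) (supported _ (r₀∉K ∘ ∈-++ˡ⁻)) ⟨
        c (colB {p} r₀) + c (colT {p})     ≡⟨ ssr·-offC x c (λ i → supported _ colC∉basis) r₀ ⟨
        (ssr x · c) r₀                     ≡⟨ c∈ker r₀ ⟩
        0F                                 ∎
        where open ≡-Reasoning

    independent-noTip : ∀ K → Independent (ssr x) (K ++ (outside ∷ Sub.⊥))
    independent-noTip K c supported kernel =
      ssr-kernel-basis K outside c supported (λ r → trans (sym (sumF≡· (ssr x) c r)) (kernel r))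
        (supported _ λ tip∈ → case ∈-++ʳ⁻ {p = K} {q = outside ∷ Sub.⊥} {j = Fin.zero} tip∈ of λ ())

    rank-⋃Lines : ∀ (K : Subset n) {i₀ r₀} → i₀ ∈ K → r₀ ∉ K → ∀ S →
                  (∀ {col} → col ∈ S → ∃ λ i → i ∈ K × col ∈ Line {p} i) →
                  (∀ {i} → i ∈ K → Line {p} i ⊆ S) →
                  HasRank (ssr x) S (suc ∣ K ∣)
    rank-⋃Lines K {i₀} {r₀} i₀∈K r₀∉K S S⊆Lines Lines⊆S =
      (I , I⊆S , independent-withTip r₀∉K , ∣I∣) ,
      λ J J⊆S J-indep → subst (∣ J ∣ ≤_) (∣p∪⁅x⁆∣≡1+∣p∣ r₀∉K) (card-independent≤ (ssr x) (K ∪ ⁅ r₀ ⁆) spans J⊆S J-indep)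
      where
      I : Subset (n ℕ.+ suc n)
      I = K ++ (inside ∷ Sub.⊥)
      ∣I∣ : ∣ I ∣ ≡ suc ∣ K ∣
      ∣I∣ = trans (∣p++q∣ K (inside ∷ Sub.⊥)) (trans (cong (λ z → ∣ K ∣ ℕ.+ suc z) (∣⊥∣≡0 n)) (ℕ.+-comm ∣ K ∣ 1))
      I⊆S : I ⊆ S
      I⊆S {col} col∈I with column {n = n} col
      ... | isB i = Lines⊆S (∈-++ˡ⁻ {q = inside ∷ Sub.⊥} col∈I) (colB∈Line i)
      ... | isT   = Lines⊆S i₀∈K (colT∈Line i₀)
      ... | isC i = contradiction col∈I colC∉basis
      spans : ∀ y → ∃ λ y′ → y′ ∈ K ∪ ⁅ r₀ ⁆ × ∀ {j} → j ∈ S → ssr x y j ≡ ssr x y′ j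
      spans y with y ∈? K
      ... | yes y∈K = y , x∈p∪q⁺ (inj₁ y∈K) , λ _ → refl
      ... | no y∉K  = r₀ , x∈p∪q⁺ (inj₂ (x∈⁅x⁆ r₀)) , agree
        where
        agree : ∀ {j} → j ∈ S → ssr x y j ≡ ssr x r₀ j
        agree j∈S with S⊆Lines j∈S
        ... | i , i∈K , j∈Line = ssr-rows-agree x (λ i≡y → y∉K (subst (_∈ K) i≡y i∈K)) (λ i≡r₀ → r₀∉K (subst (_∈ K) i≡r₀ i∈K)) j∈Line

    rank-all : HasRank (ssr x) Sub.⊤ n
    rank-all =
      (Sub.⊤ {n} ++ (outside ∷ Sub.⊥) , (λ _ → ∈⊤) , independent-noTip Sub.⊤ , ∣I∣) ,
      λ J _ J-indep → subst (∣ J ∣ ≤_) (∣⊤∣≡n n) (card-independent≤ (ssr x) Sub.⊤ (λ y → y , ∈⊤ , λ _ → refl) (λ _ → ∈⊤) J-indep)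
      where
      ∣I∣ : ∣ Sub.⊤ {n} ++ (outside ∷ Sub.⊥) ∣ ≡ n
      ∣I∣ = trans (∣p++q∣ (Sub.⊤ {n}) (outside ∷ Sub.⊥)) (trans (cong₂ ℕ._+_ (∣⊤∣≡n n) (∣⊥∣≡0 n)) (ℕ.+-identityʳ n))

    ssr-isSpikeRep : 2 ≤ n → IsSpikeRep n (ssr x)
    ssr-isSpikeRep 2≤n = rank-Line , rank-PrefixLines , rank-all
      where
      rank-Line : ∀ i → HasRank (ssr x) (Line {p} i) 2
      rank-Line i = subst (HasRank (ssr x) (Line {p} i)) (cong suc (∣⁅x⁆∣≡1 i))
        (rank-⋃Lines ⁅ i ⁆ (x∈⁅x⁆ i) (proj₂ (another 2≤n i) ∘ sym ∘ x∈⁅y⁆⇒x≡y i) (Line {p} i)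
          (λ col∈ → i , x∈⁅x⁆ i , col∈) (λ i′∈ → subst (λ i′ → Line {p} i′ ⊆ Line {p} i) (sym (x∈⁅y⁆⇒x≡y i i′∈)) id))
      rank-PrefixLines : ∀ k → 1 ≤ k → k ≤ n ∸ 1 → HasRank (ssr x) (PrefixLines {p} n k) (suc k)
      rank-PrefixLines k 1≤k k≤n-1 = subst (HasRank (ssr x) (PrefixLines {p} n k)) (cong suc (∣below∣ k≤n))
        (rank-⋃Lines (below k) (∈below⁺ (subst (_< k) (sym (toℕ-fromℕ< 0<n)) 1≤k)) last∉ (PrefixLines {p} n k)
          (λ col∈ → let i , i<k , col∈Line = ∈PrefixLines⁻ {n = n} col∈ in i , ∈below⁺ i<k , col∈Line)
          (Line⊆PrefixLines {n = n} ∘ ∈below⁻))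
        where
        0<n : 0 < n
        0<n = ℕ.<-trans (s≤s z≤n) 2≤n
        n-1<n : n ∸ 1 < n
        n-1<n = n∸1<n 0<n
        k≤n : k ≤ n
        k≤n = ℕ.≤-trans k≤n-1 (ℕ.m∸n≤m n 1)
        last∉ : fromℕ< n-1<n ∉ below k
        last∉ last∈ = ℕ.<-irrefl refl (ℕ.<-≤-trans (subst (_< k) (toℕ-fromℕ< n-1<n) (∈below⁻ last∈)) k≤n-1)

  -- Flipping and permuting the diagonal

  eliminate : ∀ {r m} → Matrix {p} r m → Fin r → GF p → GF p → Matrix {p} r m
  eliminate A i κ γ x y = if does (x Fin.≟ i) then A x y else κ * (A x y + γ * A i y)

  weakEquiv-eliminate : ∀ {r m} (A : Matrix {p} r m) i {κ γ} → κ ≢ 0F → γ ≢ 0F →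
                        WeakEquiv A (eliminate A i κ γ)
  weakEquiv-eliminate {r} {m} A i {κ} {γ} κ≢0 γ≢0 =
    weakEquiv-respʳ (scaleRows A ℓ₁ ℓ₁≢0 ◅◅ addRowToOthers A₁ i ◅◅ scaleRows A₂ ℓ₂ ℓ₂≢0) A₃≗
    where
    ℓ₁ ℓ₂ : Fin r → GF p
    ℓ₁ x = if does (x Fin.≟ i) then γ else 1F
    ℓ₂ x = if does (x Fin.≟ i) then γ ⁻¹ else κ
    ℓ₁≢0 : ∀ x → ℓ₁ x ≢ 0F
    ℓ₁≢0 x with does (x Fin.≟ i)
    ... | true  = γ≢0
    ... | false = 1F≢0F
    ℓ₂≢0 : ∀ x → ℓ₂ x ≢ 0F
    ℓ₂≢0 x with does (x Fin.≟ i)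
    ... | true  = ⁻¹-≢0 γ≢0
    ... | false = κ≢0
    A₁ A₂ : Matrix {p} r m
    A₁ x y = ℓ₁ x * A x y
    A₂ x y = if does (x Fin.≟ i) then A₁ x y else A₁ x y + A₁ i y
    A₁ᵢ : ∀ y → A₁ i y ≡ γ * A i y
    A₁ᵢ y = cong (_* A i y) (if-≟-≡ i)
    A₃≗ : ∀ x y → ℓ₂ x * A₂ x y ≡ eliminate A i κ γ x y
    A₃≗ x y = byCases (x Fin.≟ i)
      where
      open ≡-Reasoning
      byCases : Dec (x ≡ i) → ℓ₂ x * A₂ x y ≡ eliminate A i κ γ x y
      byCases (yes refl) = begin
        ℓ₂ x * A₂ x y          ≡⟨ cong₂ _*_ (if-≟-≡ x) (trans (if-≟-≡ x) (A₁ᵢ y)) ⟩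
        γ ⁻¹ * (γ * A x y)     ≡⟨ *-assoc (γ ⁻¹) γ (A x y) ⟨
        γ ⁻¹ * γ * A x y       ≡⟨ cong (_* A x y) (*-inverseˡ γ≢0) ⟩
        1F * A x y             ≡⟨ *-identityˡ (A x y) ⟩
        A x y                  ≡⟨ if-≟-≡ x ⟨
        eliminate A i κ γ x y  ∎
      byCases (no x≢i) = begin
        ℓ₂ x * A₂ x y                      ≡⟨ cong₂ _*_ (if-≟-≢ x≢i) (if-≟-≢ x≢i) ⟩
        κ * (ℓ₁ x * A x y + A₁ i y)        ≡⟨ cong₂ (λ u v → κ * (u * A x y + v)) (if-≟-≢ x≢i) (A₁ᵢ y) ⟩
        κ * (1F * A x y + γ * A i y)       ≡⟨ cong (λ u → κ * (u + γ * A i y)) (*-identityˡ (A x y)) ⟩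
        κ * (A x y + γ * A i y)            ≡⟨ if-≟-≢ x≢i ⟨
        eliminate A i κ γ x y              ∎

  flipAt : ∀ {n} → Fin n → (Fin n → GF p) → Fin n → GF p
  flipAt i x j = if does (j Fin.≟ i) then - (1F + x i) else x j * (1F + x i) * x i ⁻¹

  -- Swap the columns b_i and c_i, use row i to make the tip column 1 again, and
  -- rescale the columns to restore the identity block and the form of the c_j.
  module Flip {n : ℕ} (x : Fin n → GF p) (i : Fin n) (a≢0 : x i ≢ 0F) (s≢0 : 1F + x i ≢ 0F) where

    open ≡-Reasoning

    a s κ γ : GF p
    a = x i
    s = 1F + a
    κ = s * a ⁻¹
    γ = - s ⁻¹

    κ[1+γ]≡1 : κ * (1F + γ) ≡ 1F
    κ[1+γ]≡1 = begin
      κ * (1F + γ)               ≡⟨ solve 3 (λ a a′ s′ → (con ℤ.1ℤ :+ a) :* a′ :* (con ℤ.1ℤ :+ :- s′) := a′ :* ((con ℤ.1ℤ :+ a) :+ :- ((con ℤ.1ℤ :+ a) :* s′))) refl a (a ⁻¹) (s ⁻¹) ⟩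
      a ⁻¹ * (s + - (s * s ⁻¹))  ≡⟨ cong (λ z → a ⁻¹ * (s + - z)) (*-inverseʳ s≢0) ⟩
      a ⁻¹ * (s + - 1F)          ≡⟨ solve 2 (λ a a′ → a′ :* ((con ℤ.1ℤ :+ a) :+ :- con ℤ.1ℤ) := a′ :* a) refl a (a ⁻¹) ⟩
      a ⁻¹ * a                   ≡⟨ *-inverseˡ a≢0 ⟩
      1F                         ∎

    1+γs≡0 : 1F + γ * s ≡ 0F
    1+γs≡0 = begin
      1F + γ * s                 ≡⟨ solve 2 (λ s s′ → con ℤ.1ℤ :+ (:- s′) :* s := con ℤ.1ℤ :+ :- (s :* s′)) refl s (s ⁻¹) ⟩
      1F + - (s * s ⁻¹)          ≡⟨ cong (λ z → 1F + - z) (*-inverseʳ s≢0) ⟩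
      1F + - 1F                  ≡⟨ +-inverseʳ 1F ⟩
      0F                         ∎

    [aa⁻¹][ss⁻¹]≡1 : (a * a ⁻¹) * (s * s ⁻¹) ≡ 1F
    [aa⁻¹][ss⁻¹]≡1 = trans (cong₂ _*_ (*-inverseʳ a≢0) (*-inverseʳ s≢0)) (*-identityˡ 1F)

    -aκγ≡1 : - a * (κ * γ) ≡ 1F
    -aκγ≡1 = trans (solve 3 (λ a a′ s′ → (:- a) :* ((con ℤ.1ℤ :+ a) :* a′ :* (:- s′)) := (a :* a′) :* ((con ℤ.1ℤ :+ a) :* s′)) refl a (a ⁻¹) (s ⁻¹)) [aa⁻¹][ss⁻¹]≡1

    as⁻¹κ≡1 : a * s ⁻¹ * κ ≡ 1F
    as⁻¹κ≡1 = trans (solve 3 (λ a a′ s′ → a :* s′ :* ((con ℤ.1ℤ :+ a) :* a′) := (a :* a′) :* ((con ℤ.1ℤ :+ a) :* s′)) refl a (a ⁻¹) (s ⁻¹)) [aa⁻¹][ss⁻¹]≡1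

    swapped : Matrix {p} n (n ℕ.+ suc n)
    swapped r col = ssr x r (swapIdx {p} (colB {p} i) (colC {p} i) col)

    swapped-colBᵢ : ∀ r → swapped r (colB {p} i) ≡ 1F + a * δ i r
    swapped-colBᵢ r = trans (cong (ssr x r) (swapIdx-left (colB {p} i) (colC {p} i))) (ssr-colC x r i)

    swapped-colCᵢ : ∀ r → swapped r (colC {p} i) ≡ δ i r
    swapped-colCᵢ r = trans (cong (ssr x r) (swapIdx-right (colB {p} i) (colC {p} i))) (ssr-colB x r i)

    swapped-colB : ∀ {j} r → j ≢ i → swapped r (colB {p} j) ≡ δ j r
    swapped-colB r j≢i = trans (cong (ssr x r) (swapIdx-other (j≢i ∘ colB-injective) colB≢colC)) (ssr-colB x r _)

    swapped-colT : ∀ r → swapped r (colT {p}) ≡ 1F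
    swapped-colT r = trans (cong (ssr x r) (swapIdx-other (colB≢colT ∘ sym) colT≢colC)) (ssr-colT x r)

    swapped-colC : ∀ {j} r → j ≢ i → swapped r (colC {p} j) ≡ 1F + x j * δ j r
    swapped-colC r j≢i = trans (cong (ssr x r) (swapIdx-other (colB≢colC ∘ sym) (j≢i ∘ colC-injective))) (ssr-colC x r _)

    elim : Matrix {p} n (n ℕ.+ suc n)
    elim = eliminate swapped i κ γ

    elim-≡ : ∀ col → elim i col ≡ swapped i col
    elim-≡ col = if-≟-≡ i

    elim-≢ : ∀ {r} col → r ≢ i → elim r col ≡ κ * (swapped r col + γ * swapped i col)
    elim-≢ col r≢i = if-≟-≢ r≢i

    μB μC : Fin n → GF p
    μB j = if does (j Fin.≟ i) then s ⁻¹ else a * s ⁻¹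
    μC j = if does (j Fin.≟ i) then - a else 1F

    μ : Fin (n ℕ.+ suc n) → GF p
    μ = byColumn μB 1F μC

    μ≢0 : ∀ col → μ col ≢ 0F
    μ≢0 col with column {n = n} col
    ... | isB j = subst (_≢ 0F) (sym (byColumn-colB μB 1F μC j)) (if-≢0 (does (j Fin.≟ i)) (⁻¹-≢0 s≢0) (*-≢0 a≢0 (⁻¹-≢0 s≢0)))
    ... | isT   = subst (_≢ 0F) (sym (byColumn-colT μB 1F μC)) 1F≢0F
    ... | isC j = subst (_≢ 0F) (sym (byColumn-colC μB 1F μC j)) (if-≢0 (does (j Fin.≟ i)) (-‿≢0 a≢0) 1F≢0F)

    y : Fin n → GF p
    y = flipAt i x

    μ-colBᵢ : μ (colB {p} i) ≡ s ⁻¹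
    μ-colBᵢ = trans (byColumn-colB μB 1F μC i) (if-≟-≡ i)

    μ-colB : ∀ {j} → j ≢ i → μ (colB {p} j) ≡ a * s ⁻¹
    μ-colB j≢i = trans (byColumn-colB μB 1F μC _) (if-≟-≢ j≢i)

    μ-colCᵢ : μ (colC {p} i) ≡ - a
    μ-colCᵢ = trans (byColumn-colC μB 1F μC i) (if-≟-≡ i)

    μ-colC : ∀ {j} → j ≢ i → μ (colC {p} j) ≡ 1F
    μ-colC j≢i = trans (byColumn-colC μB 1F μC _) (if-≟-≢ j≢i)

    δᵢᵢ : δ i i ≡ 1F {p}
    δᵢᵢ = δ-≡ i

    entry-colT : ∀ r → μ (colT {p}) * elim r (colT {p}) ≡ ssr y r (colT {p})
    entry-colT r = trans (cong₂ _*_ (byColumn-colT μB 1F μC) (byCases (r Fin.≟ i)))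
                         (trans (*-identityˡ 1F) (sym (ssr-colT y r)))
      where
      byCases : Dec (r ≡ i) → elim r (colT {p}) ≡ 1F
      byCases (yes refl) = trans (elim-≡ (colT {p})) (swapped-colT i)
      byCases (no r≢i)   = begin
        elim r (colT {p})                  ≡⟨ elim-≢ (colT {p}) r≢i ⟩
        κ * (swapped r (colT {p}) + γ * swapped i (colT {p})) ≡⟨ cong₂ (λ u v → κ * (u + γ * v)) (swapped-colT r) (swapped-colT i) ⟩
        κ * (1F + γ * 1F)                  ≡⟨ cong (λ z → κ * (1F + z)) (*-identityʳ γ) ⟩
        κ * (1F + γ)                       ≡⟨ κ[1+γ]≡1 ⟩
        1F                                 ∎

    entry-colBᵢ : ∀ r → μ (colB {p} i) * elim r (colB {p} i) ≡ ssr y r (colB {p} i)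
    entry-colBᵢ r = begin
      μ (colB {p} i) * elim r (colB {p} i)  ≡⟨ cong (_* elim r (colB {p} i)) μ-colBᵢ ⟩
      s ⁻¹ * elim r (colB {p} i)            ≡⟨ byCases (r Fin.≟ i) ⟩
      δ i r                                 ≡⟨ ssr-colB y r i ⟨
      ssr y r (colB {p} i)                  ∎
      where
      byCases : Dec (r ≡ i) → s ⁻¹ * elim r (colB {p} i) ≡ δ i r
      byCases (yes refl) = begin
        s ⁻¹ * elim i (colB {p} i)          ≡⟨ cong (s ⁻¹ *_) (trans (elim-≡ (colB {p} i)) (swapped-colBᵢ i)) ⟩
        s ⁻¹ * (1F + a * δ i i)             ≡⟨ cong (λ d → s ⁻¹ * (1F + a * d)) δᵢᵢ ⟩
        s ⁻¹ * (1F + a * 1F)                ≡⟨ cong (λ z → s ⁻¹ * (1F + z)) (*-identityʳ a) ⟩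
        s ⁻¹ * s                            ≡⟨ *-inverseˡ s≢0 ⟩
        1F                                  ≡⟨ δᵢᵢ ⟨
        δ i i                               ∎
      byCases (no r≢i) = begin
        s ⁻¹ * elim r (colB {p} i)                                   ≡⟨ cong (s ⁻¹ *_) (elim-≢ (colB {p} i) r≢i) ⟩
        s ⁻¹ * (κ * (swapped r (colB {p} i) + γ * swapped i (colB {p} i)))
                                                                     ≡⟨ cong₂ (λ u v → s ⁻¹ * (κ * (u + γ * v))) (swapped-colBᵢ r) (swapped-colBᵢ i) ⟩
        s ⁻¹ * (κ * ((1F + a * δ i r) + γ * (1F + a * δ i i)))       ≡⟨ cong₂ (λ d e → s ⁻¹ * (κ * ((1F + a * d) + γ * (1F + a * e)))) (δ-≢ (r≢i ∘ sym)) δᵢᵢ ⟩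
        s ⁻¹ * (κ * ((1F + a * 0F) + γ * (1F + a * 1F)))             ≡⟨ solve 4 (λ s′ k g a → s′ :* (k :* ((con ℤ.1ℤ :+ a :* con ℤ.0ℤ) :+ g :* (con ℤ.1ℤ :+ a :* con ℤ.1ℤ))) := s′ :* k :* (con ℤ.1ℤ :+ g :* (con ℤ.1ℤ :+ a))) refl (s ⁻¹) κ γ a ⟩
        s ⁻¹ * κ * (1F + γ * s)                                      ≡⟨ cong (s ⁻¹ * κ *_) 1+γs≡0 ⟩
        s ⁻¹ * κ * 0F                                                ≡⟨ zeroʳ _ ⟩
        0F                                                           ≡⟨ δ-≢ (r≢i ∘ sym) ⟨
        δ i r                                                        ∎

    entry-colB : ∀ {j} r → j ≢ i → μ (colB {p} j) * elim r (colB {p} j) ≡ ssr y r (colB {p} j)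
    entry-colB {j} r j≢i = begin
      μ (colB {p} j) * elim r (colB {p} j)  ≡⟨ cong (_* elim r (colB {p} j)) (μ-colB j≢i) ⟩
      a * s ⁻¹ * elim r (colB {p} j)        ≡⟨ byCases (r Fin.≟ i) ⟩
      δ j r                                 ≡⟨ ssr-colB y r j ⟨
      ssr y r (colB {p} j)                  ∎
      where
      δⱼᵢ : δ j i ≡ 0F
      δⱼᵢ = δ-≢ j≢i
      byCases : Dec (r ≡ i) → a * s ⁻¹ * elim r (colB {p} j) ≡ δ j r
      byCases (yes refl) = begin
        a * s ⁻¹ * elim i (colB {p} j)      ≡⟨ cong (a * s ⁻¹ *_) (trans (elim-≡ (colB {p} j)) (swapped-colB i j≢i)) ⟩
        a * s ⁻¹ * δ j i                    ≡⟨ cong (a * s ⁻¹ *_) δⱼᵢ ⟩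
        a * s ⁻¹ * 0F                       ≡⟨ zeroʳ _ ⟩
        0F                                  ≡⟨ δⱼᵢ ⟨
        δ j i                               ∎
      byCases (no r≢i) = begin
        a * s ⁻¹ * elim r (colB {p} j)                               ≡⟨ cong (a * s ⁻¹ *_) (elim-≢ (colB {p} j) r≢i) ⟩
        a * s ⁻¹ * (κ * (swapped r (colB {p} j) + γ * swapped i (colB {p} j)))
                                                                     ≡⟨ cong₂ (λ u v → a * s ⁻¹ * (κ * (u + γ * v))) (swapped-colB r j≢i) (swapped-colB i j≢i) ⟩
        a * s ⁻¹ * (κ * (δ j r + γ * δ j i))                         ≡⟨ cong (λ d → a * s ⁻¹ * (κ * (δ j r + γ * d))) δⱼᵢ ⟩
        a * s ⁻¹ * (κ * (δ j r + γ * 0F))                            ≡⟨ solve 4 (λ c k d g → c :* (k :* (d :+ g :* con ℤ.0ℤ)) := c :* k :* d) refl (a * s ⁻¹) κ (δ j r) γ ⟩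
        a * s ⁻¹ * κ * δ j r                                         ≡⟨ cong (_* δ j r) as⁻¹κ≡1 ⟩
        1F * δ j r                                                   ≡⟨ *-identityˡ _ ⟩
        δ j r                                                        ∎

    entry-colCᵢ : ∀ r → μ (colC {p} i) * elim r (colC {p} i) ≡ ssr y r (colC {p} i)
    entry-colCᵢ r = begin
      μ (colC {p} i) * elim r (colC {p} i)  ≡⟨ cong (_* elim r (colC {p} i)) μ-colCᵢ ⟩
      - a * elim r (colC {p} i)             ≡⟨ byCases (r Fin.≟ i) ⟩
      1F + - s * δ i r                      ≡⟨ cong (λ z → 1F + z * δ i r) (if-≟-≡ i) ⟨
      1F + y i * δ i r                      ≡⟨ ssr-colC y r i ⟨
      ssr y r (colC {p} i)                  ∎
      where
      byCases : Dec (r ≡ i) → - a * elim r (colC {p} i) ≡ 1F + - s * δ i r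
      byCases (yes refl) = begin
        - a * elim i (colC {p} i)           ≡⟨ cong (- a *_) (trans (elim-≡ (colC {p} i)) (swapped-colCᵢ i)) ⟩
        - a * δ i i                         ≡⟨ cong (λ d → - a * d) δᵢᵢ ⟩
        - a * 1F                            ≡⟨ solve 1 (λ a → (:- a) :* con ℤ.1ℤ := con ℤ.1ℤ :+ (:- (con ℤ.1ℤ :+ a)) :* con ℤ.1ℤ) refl a ⟩
        1F + - s * 1F                       ≡⟨ cong (λ d → 1F + - s * d) δᵢᵢ ⟨
        1F + - s * δ i i                    ∎
      byCases (no r≢i) = begin
        - a * elim r (colC {p} i)                                    ≡⟨ cong (- a *_) (elim-≢ (colC {p} i) r≢i) ⟩
        - a * (κ * (swapped r (colC {p} i) + γ * swapped i (colC {p} i)))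
                                                                     ≡⟨ cong₂ (λ u v → - a * (κ * (u + γ * v))) (swapped-colCᵢ r) (swapped-colCᵢ i) ⟩
        - a * (κ * (δ i r + γ * δ i i))                              ≡⟨ cong₂ (λ d e → - a * (κ * (d + γ * e))) (δ-≢ (r≢i ∘ sym)) δᵢᵢ ⟩
        - a * (κ * (0F + γ * 1F))                                    ≡⟨ solve 3 (λ a k g → (:- a) :* (k :* (con ℤ.0ℤ :+ g :* con ℤ.1ℤ)) := (:- a) :* (k :* g)) refl a κ γ ⟩
        - a * (κ * γ)                                                ≡⟨ -aκγ≡1 ⟩
        1F                                                           ≡⟨ solve 1 (λ s → con ℤ.1ℤ := con ℤ.1ℤ :+ (:- s) :* con ℤ.0ℤ) refl s ⟩
        1F + - s * 0F                                                ≡⟨ cong (λ d → 1F + - s * d) (δ-≢ (r≢i ∘ sym)) ⟨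
        1F + - s * δ i r                                             ∎

    entry-colC : ∀ {j} r → j ≢ i → μ (colC {p} j) * elim r (colC {p} j) ≡ ssr y r (colC {p} j)
    entry-colC {j} r j≢i = begin
      μ (colC {p} j) * elim r (colC {p} j)  ≡⟨ cong (_* elim r (colC {p} j)) (μ-colC j≢i) ⟩
      1F * elim r (colC {p} j)              ≡⟨ *-identityˡ _ ⟩
      elim r (colC {p} j)                   ≡⟨ byCases (r Fin.≟ i) ⟩
      1F + x j * s * a ⁻¹ * δ j r           ≡⟨ cong (λ z → 1F + z * δ j r) (if-≟-≢ j≢i) ⟨
      1F + y j * δ j r                      ≡⟨ ssr-colC y r j ⟨
      ssr y r (colC {p} j)                  ∎
      where
      δⱼᵢ : δ j i ≡ 0F
      δⱼᵢ = δ-≢ j≢i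
      byCases : Dec (r ≡ i) → elim r (colC {p} j) ≡ 1F + x j * s * a ⁻¹ * δ j r
      byCases (yes refl) = begin
        elim i (colC {p} j)                 ≡⟨ trans (elim-≡ (colC {p} j)) (swapped-colC i j≢i) ⟩
        1F + x j * δ j i                    ≡⟨ cong (λ d → 1F + x j * d) δⱼᵢ ⟩
        1F + x j * 0F                       ≡⟨ solve 2 (λ u v → con ℤ.1ℤ :+ u :* con ℤ.0ℤ := con ℤ.1ℤ :+ v :* con ℤ.0ℤ) refl (x j) (x j * s * a ⁻¹) ⟩
        1F + x j * s * a ⁻¹ * 0F            ≡⟨ cong (λ d → 1F + x j * s * a ⁻¹ * d) δⱼᵢ ⟨
        1F + x j * s * a ⁻¹ * δ j i         ∎
      byCases (no r≢i) = begin
        elim r (colC {p} j)                                          ≡⟨ elim-≢ (colC {p} j) r≢i ⟩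
        κ * (swapped r (colC {p} j) + γ * swapped i (colC {p} j))    ≡⟨ cong₂ (λ u v → κ * (u + γ * v)) (swapped-colC r j≢i) (swapped-colC i j≢i) ⟩
        κ * ((1F + x j * δ j r) + γ * (1F + x j * δ j i))            ≡⟨ cong (λ d → κ * ((1F + x j * δ j r) + γ * (1F + x j * d))) δⱼᵢ ⟩
        κ * ((1F + x j * δ j r) + γ * (1F + x j * 0F))               ≡⟨ solve 5 (λ s a′ g xj d → (s :* a′) :* ((con ℤ.1ℤ :+ xj :* d) :+ g :* (con ℤ.1ℤ :+ xj :* con ℤ.0ℤ)) := (s :* a′) :* (con ℤ.1ℤ :+ g) :+ xj :* s :* a′ :* d) refl s (a ⁻¹) γ (x j) (δ j r) ⟩
        κ * (1F + γ) + x j * s * a ⁻¹ * δ j r                         ≡⟨ cong (_+ x j * s * a ⁻¹ * δ j r) κ[1+γ]≡1 ⟩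
        1F + x j * s * a ⁻¹ * δ j r                                   ∎

    entry : ∀ r col → μ col * elim r col ≡ ssr y r col
    entry r col with column {n = n} col
    ... | isT   = entry-colT r
    ... | isB j = byCasesB j (j Fin.≟ i)
      where
      byCasesB : ∀ j → Dec (j ≡ i) → μ (colB {p} j) * elim r (colB {p} j) ≡ ssr y r (colB {p} j)
      byCasesB j (yes refl) = entry-colBᵢ r
      byCasesB j (no j≢i)   = entry-colB r j≢i
    ... | isC j = byCasesC j (j Fin.≟ i)
      where
      byCasesC : ∀ j → Dec (j ≡ i) → μ (colC {p} j) * elim r (colC {p} j) ≡ ssr y r (colC {p} j)
      byCasesC j (yes refl) = entry-colCᵢ r
      byCasesC j (no j≢i)   = entry-colC r j≢i

    weakEquiv-flip : WeakEquiv (ssr x) (ssr y)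
    weakEquiv-flip = weakEquiv-respʳ
      ((colSwap (colB {p} i) (colC {p} i) (λ _ _ → refl) ◅ ε)
        ◅◅ weakEquiv-eliminate swapped i (*-≢0 s≢0 (⁻¹-≢0 a≢0)) (-‿≢0 (⁻¹-≢0 s≢0))
        ◅◅ scaleCols elim μ μ≢0)
      entry

  weakEquiv-swapIndices : ∀ {n} (x : Fin n → GF p) (k l : Fin n) → WeakEquiv (ssr x) (ssr (x ∘ swapIdx {p} k l))
  weakEquiv-swapIndices {n} x k l = weakEquiv-respʳ
    ((colSwap (colB {p} k) (colB {p} l) (λ _ _ → refl) ◅ ε)
      ◅◅ (colSwap (colC {p} k) (colC {p} l) (λ _ _ → refl) ◅ ε)
      ◅◅ (rowSwap k l (λ _ _ → refl) ◅ ε))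
    entry
    where
    σ : Fin n → Fin n
    σ = swapIdx {p} k l
    τ : Fin (n ℕ.+ suc n) → Fin (n ℕ.+ suc n)
    τ col = swapIdx {p} (colB {p} k) (colB {p} l) (swapIdx {p} (colC {p} k) (colC {p} l) col)
    σ-injective : ∀ {u v} → σ u ≡ σ v → u ≡ v
    σ-injective = swapIdx-injective k l
    entry : ∀ r col → ssr x (σ r) (τ col) ≡ ssr (x ∘ σ) r col
    entry r col with column {n = n} col
    ... | isB j = begin
      ssr x (σ r) (τ (colB {p} j))      ≡⟨ cong (λ c → ssr x (σ r) (swapIdx {p} (colB {p} k) (colB {p} l) c)) (swapIdx-other {a = colC {p} k} {colC {p} l} {colB {p} j} colB≢colC colB≢colC) ⟩
      ssr x (σ r) (swapIdx {p} (colB {p} k) (colB {p} l) (colB {p} j)) ≡⟨ cong (ssr x (σ r)) (swapIdx-natural (colB {p}) colB-injective k l j) ⟩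
      ssr x (σ r) (colB {p} (σ j))      ≡⟨ ssr-colB x (σ r) (σ j) ⟩
      δ (σ j) (σ r)                     ≡⟨ δ-injective σ σ-injective j r ⟩
      δ j r                             ≡⟨ ssr-colB (x ∘ σ) r j ⟨
      ssr (x ∘ σ) r (colB {p} j)        ∎
      where open ≡-Reasoning
    ... | isT = begin
      ssr x (σ r) (τ (colT {p}))        ≡⟨ cong (ssr x (σ r)) (trans (cong (swapIdx {p} (colB {p} k) (colB {p} l)) (swapIdx-other {a = colC {p} k} {colC {p} l} {colT {p}} colT≢colC colT≢colC)) (swapIdx-other {a = colB {p} k} {colB {p} l} {colT {p}} (colB≢colT ∘ sym) (colB≢colT ∘ sym))) ⟩
      ssr x (σ r) (colT {p})            ≡⟨ trans (ssr-colT x (σ r)) (sym (ssr-colT (x ∘ σ) r)) ⟩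
      ssr (x ∘ σ) r (colT {p})          ∎
      where open ≡-Reasoning
    ... | isC j = begin
      ssr x (σ r) (τ (colC {p} j))      ≡⟨ cong (λ c → ssr x (σ r) (swapIdx {p} (colB {p} k) (colB {p} l) c)) (swapIdx-natural (colC {p}) colC-injective k l j) ⟩
      ssr x (σ r) (swapIdx {p} (colB {p} k) (colB {p} l) (colC {p} (σ j))) ≡⟨ cong (ssr x (σ r)) (swapIdx-other {a = colB {p} k} {colB {p} l} {colC {p} (σ j)} (colB≢colC ∘ sym) (colB≢colC ∘ sym)) ⟩
      ssr x (σ r) (colC {p} (σ j))      ≡⟨ ssr-colC x (σ r) (σ j) ⟩
      1F + x (σ j) * δ (σ j) (σ r)      ≡⟨ cong (λ d → 1F + x (σ j) * d) (δ-injective σ σ-injective j r) ⟩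
      1F + x (σ j) * δ j r              ≡⟨ ssr-colC (x ∘ σ) r j ⟨
      ssr (x ∘ σ) r (colC {p} j)        ∎
      where open ≡-Reasoning

  negateAt : ∀ {n} → Fin n → (Fin n → GF p) → Fin n → GF p
  negateAt i v j = if does (j Fin.≟ i) then - v i else v j

  -- x j = d / v j: the diagonal in homogeneous coordinates (d : v)
  _≈_∶_ : ∀ {n} → (Fin n → GF p) → GF p → (Fin n → GF p) → Set
  x ≈ d ∶ v = ∀ j → x j * v j ≡ d

  flipAt-≈ : ∀ {n} {x : Fin n → GF p} {d v} i → x ≈ d ∶ v → x i ≢ 0F → flipAt i x ≈ d + v i ∶ negateAt i v
  flipAt-≈ {x = x} {d} {v} i x≈d∶v xᵢ≢0 j = byCases (j Fin.≟ i)
    where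
    open ≡-Reasoning
    byCases : Dec (j ≡ i) → flipAt i x j * negateAt i v j ≡ d + v i
    byCases (yes refl) = begin
      flipAt j x j * negateAt j v j      ≡⟨ cong₂ _*_ (if-≟-≡ j) (if-≟-≡ j) ⟩
      - (1F + x j) * - v j               ≡⟨ solve 2 (λ x v → (:- (con ℤ.1ℤ :+ x)) :* (:- v) := x :* v :+ v) refl (x j) (v j) ⟩
      x j * v j + v j                    ≡⟨ cong (_+ v j) (x≈d∶v j) ⟩
      d + v j                            ∎
    byCases (no j≢i) = begin
      flipAt i x j * negateAt i v j                    ≡⟨ cong₂ _*_ (if-≟-≢ j≢i) (if-≟-≢ j≢i) ⟩
      x j * (1F + x i) * x i ⁻¹ * v j                  ≡⟨ solve 4 (λ xj xi xi′ vj → xj :* (con ℤ.1ℤ :+ xi) :* xi′ :* vj := xj :* vj :* xi′ :+ xj :* vj :* (xi :* xi′)) refl (x j) (x i) (x i ⁻¹) (v j) ⟩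
      x j * v j * x i ⁻¹ + x j * v j * (x i * x i ⁻¹)  ≡⟨ cong₂ (λ u w → u * x i ⁻¹ + u * w) (x≈d∶v j) (*-inverseʳ xᵢ≢0) ⟩
      d * x i ⁻¹ + d * 1F                              ≡⟨ cong (λ u → u * x i ⁻¹ + d * 1F) (x≈d∶v i) ⟨
      x i * v i * x i ⁻¹ + d * 1F                      ≡⟨ solve 4 (λ xi vi xi′ d → xi :* vi :* xi′ :+ d :* con ℤ.1ℤ := d :+ vi :* (xi :* xi′)) refl (x i) (v i) (x i ⁻¹) d ⟩
      d + v i * (x i * x i ⁻¹)                         ≡⟨ cong (λ w → d + v i * w) (*-inverseʳ xᵢ≢0) ⟩
      d + v i * 1F                                     ≡⟨ cong (d +_) (*-identityʳ (v i)) ⟩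
      d + v i                                          ∎

  ReachesMinusOne : ∀ {n} → (Fin n → GF p) → Set
  ReachesMinusOne x = ∃ λ y → (∀ j → y j ≢ 0F) × (∃ λ k → y k ≡ -1F) × WeakEquiv (ssr x) (ssr y)

  module _ {n} {x : Fin n → GF p} {d v} (x≈d∶v : x ≈ d ∶ v) (d≢0 : d ≢ 0F) where

    ≈-≢0 : ∀ j → x j ≢ 0F
    ≈-≢0 j xⱼ≡0 = d≢0 (trans (sym (x≈d∶v j)) (trans (cong (_* v j) xⱼ≡0) (zeroˡ (v j))))

    ≈-minusOne : ∀ k → d + v k ≡ 0F → ReachesMinusOne x
    ≈-minusOne k d+vₖ≡0 = x , ≈-≢0 , (k , xₖ≡-1) , ε
      where
      vₖ≢0 : v k ≢ 0F
      vₖ≢0 vₖ≡0 = d≢0 (trans (sym (x≈d∶v k)) (trans (cong (x k *_) vₖ≡0) (zeroʳ (x k))))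
      xₖ≡-1 : x k ≡ -1F
      xₖ≡-1 = trans (*-cancelˡ (x k) (- 1F) vₖ≢0 (begin
        v k * x k      ≡⟨ *-comm (v k) (x k) ⟩
        x k * v k      ≡⟨ x≈d∶v k ⟩
        d              ≡⟨ +-inverseˡ-unique d (v k) d+vₖ≡0 ⟩
        - v k          ≡⟨ solve 1 (λ v → :- v := v :* (:- con ℤ.1ℤ)) refl (v k) ⟩
        v k * - 1F     ∎)) (sym -1F≡-1F)
        where open ≡-Reasoning

    1+xᵢ≢0 : ∀ i → d + v i ≢ 0F → 1F + x i ≢ 0F
    1+xᵢ≢0 i d+vᵢ≢0 1+xᵢ≡0 = d+vᵢ≢0 (begin
      d + v i               ≡⟨ cong (_+ v i) (x≈d∶v i) ⟨
      x i * v i + v i       ≡⟨ solve 2 (λ x v → x :* v :+ v := v :* (con ℤ.1ℤ :+ x)) refl (x i) (v i) ⟩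
      v i * (1F + x i)      ≡⟨ cong (v i *_) 1+xᵢ≡0 ⟩
      v i * 0F              ≡⟨ zeroʳ (v i) ⟩
      0F                    ∎)
      where open ≡-Reasoning

  -- Flipping at the head i of L adds v i to d, leaving the invariant with the tail.
  walk : ∀ {n} (L : List (Fin n)) {x : Fin n → GF p} {d v k} → Unique (k ∷ L) → d ≢ 0F → x ≈ d ∶ v →
         d + listSum (map v (k ∷ L)) ≡ 0F → ReachesMinusOne x
  walk [] {d = d} {v} {k} _ d≢0 x≈d∶v d+Σ≡0 = ≈-minusOne x≈d∶v d≢0 k (trans (cong (d +_) (sym (+-identityʳ (v k)))) d+Σ≡0)
  walk (i ∷ L) {x} {d} {v} {k} ((k≢i ∷ k∉L) ∷ (i∉L ∷ unique)) d≢0 x≈d∶v d+Σ≡0 with (d + v i) Fin.≟ 0F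
  ... | yes d+vᵢ≡0 = ≈-minusOne x≈d∶v d≢0 i d+vᵢ≡0
  ... | no d+vᵢ≢0 with walk L (k∉L ∷ unique) d+vᵢ≢0 (flipAt-≈ i x≈d∶v xᵢ≢0) d′+Σ′≡0
    where
    xᵢ≢0 : x i ≢ 0F
    xᵢ≢0 = ≈-≢0 x≈d∶v d≢0 i
    d′+Σ′≡0 : (d + v i) + listSum (map (negateAt i v) (k ∷ L)) ≡ 0F
    d′+Σ′≡0 = begin
      (d + v i) + listSum (map (negateAt i v) (k ∷ L))   ≡⟨ cong₂ (λ u w → (d + v i) + (u + w)) (if-≟-≢ k≢i) (listSum-map-cong (All.map (λ i≢j → if-≟-≢ (i≢j ∘ sym)) i∉L)) ⟩
      (d + v i) + (v k + listSum (map v L))             ≡⟨ solve 4 (λ d vi vk s → (d :+ vi) :+ (vk :+ s) := d :+ (vk :+ (vi :+ s))) refl d (v i) (v k) (listSum (map v L)) ⟩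
      d + listSum (map v (k ∷ i ∷ L))                   ≡⟨ d+Σ≡0 ⟩
      0F                                                ∎
      where open ≡-Reasoning
  ...   | y , y≢0 , minusOne , x′∼y =
    y , y≢0 , minusOne , Flip.weakEquiv-flip x i (≈-≢0 x≈d∶v d≢0 i) (1+xᵢ≢0 x≈d∶v d≢0 i d+vᵢ≢0) ◅◅ x′∼y

  -- Subset sums

  shift : GF p → Subset p → Subset p
  shift a S = tabulate λ t → lookup S (t + - a)

  ∈-shift⁻ : ∀ {a S t} → t ∈ shift a S → t + - a ∈ S
  ∈-shift⁻ {a} {S} {t} t∈ = lookup⇒[]= (t + - a) S (trans (sym (lookup∘tabulate _ t)) ([]=⇒lookup t∈))

  ∈-shift⁺ : ∀ {a S t} → t ∈ S → t + a ∈ shift a S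
  ∈-shift⁺ {a} {S} {t} t∈ = lookup⇒[]= (t + a) _ (begin
    lookup (shift a S) (t + a)   ≡⟨ lookup∘tabulate _ (t + a) ⟩
    lookup S (t + a + - a)       ≡⟨ cong (lookup S) (solve 2 (λ t a → t :+ a :+ :- a := t) refl t a) ⟩
    lookup S t                   ≡⟨ []=⇒lookup t∈ ⟩
    inside                       ∎)
    where open ≡-Reasoning

  subsetSums : ∀ {n} → (Fin n → GF p) → Subset p
  subsetSums {zero}  u = ⁅ 0F ⁆
  subsetSums {suc n} u = subsetSums (u ∘ Fin.suc) ∪ shift (u Fin.zero) (subsetSums (u ∘ Fin.suc))

  IsSubsetSum : ∀ {n} → (Fin n → GF p) → GF p → Set
  IsSubsetSum u t = ∃ λ L → Unique L × listSum (map u L) ≡ t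

  subsetSums-sound : ∀ {n} (u : Fin n → GF p) {t} → t ∈ subsetSums u → IsSubsetSum u t
  subsetSums-sound {zero}  u t∈ = [] , [] , sym (x∈⁅y⁆⇒x≡y _ t∈)
  subsetSums-sound {suc n} u {t} t∈ with x∈p∪q⁻ _ _ t∈
  ... | inj₁ t∈S with subsetSums-sound (u ∘ Fin.suc) t∈S
  ...   | L , unique , Σ≡t = map Fin.suc L , Unique.map⁺ Fin.suc-injective unique , trans (cong listSum (sym (List.map-∘ L))) Σ≡t
  subsetSums-sound {suc n} u {t} t∈ | inj₂ t∈shift with subsetSums-sound (u ∘ Fin.suc) (∈-shift⁻ t∈shift)
  ...   | L , unique , Σ≡t-u₀ =
    Fin.zero ∷ map Fin.suc L ,
    All.map⁺ (All.universal (λ _ ()) L) ∷ Unique.map⁺ Fin.suc-injective unique ,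
    (begin
      u Fin.zero + listSum (map u (map Fin.suc L))   ≡⟨ cong (λ z → u Fin.zero + listSum z) (List.map-∘ L) ⟨
      u Fin.zero + listSum (map (u ∘ Fin.suc) L)     ≡⟨ cong (u Fin.zero +_) Σ≡t-u₀ ⟩
      u Fin.zero + (t + - u Fin.zero)                ≡⟨ solve 2 (λ a t → a :+ (t :+ :- a) := t) refl (u Fin.zero) t ⟩
      t                                              ∎)
    where open ≡-Reasoning

  0∈subsetSums : ∀ {n} (u : Fin n → GF p) → 0F ∈ subsetSums u
  0∈subsetSums {zero}  u = x∈⁅x⁆ 0F
  0∈subsetSums {suc n} u = x∈p∪q⁺ (inj₁ (0∈subsetSums (u ∘ Fin.suc)))

  -- every t is the multiple (t a⁻¹) a of a
  closed⇒full : ∀ {S a} → a ≢ 0F → 0F ∈ S → (∀ {t} → t ∈ S → t + a ∈ S) → ∀ t → t ∈ S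
  closed⇒full {S} {a} a≢0 0∈S closed t = subst (_∈ S) t′*a≡t (multiples (toℕ (t * a ⁻¹)))
    where
    multiples : ∀ m → m mod p * a ∈ S
    multiples zero    = subst (_∈ S) (sym (zeroˡ a)) 0∈S
    multiples (suc m) = subst (_∈ S) (begin
      m mod p * a + a          ≡⟨ solve 2 (λ c a → c :* a :+ a := (con ℤ.1ℤ :+ c) :* a) refl (m mod p) a ⟩
      (1F + m mod p) * a       ≡⟨ cong (_* a) (mod-+ 1 m) ⟨
      suc m mod p * a          ∎) (closed (multiples m))
      where open ≡-Reasoning
    t′*a≡t : toℕ (t * a ⁻¹) mod p * a ≡ t
    t′*a≡t = begin
      toℕ (t * a ⁻¹) mod p * a   ≡⟨ cong (_* a) (mod-toℕ (t * a ⁻¹)) ⟩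
      t * a ⁻¹ * a               ≡⟨ *-assoc t (a ⁻¹) a ⟩
      t * (a ⁻¹ * a)             ≡⟨ cong (t *_) (*-inverseˡ a≢0) ⟩
      t * 1F                     ≡⟨ *-identityʳ t ⟩
      t                          ∎
      where open ≡-Reasoning

  -- a new summand either adds a new sum or the old sums are closed under adding it
  subsetSums-full-or-large : ∀ {n} (u : Fin n → GF p) → (∀ j → u j ≢ 0F) →
                             (∀ t → t ∈ subsetSums u) ⊎ n < ∣ subsetSums u ∣
  subsetSums-full-or-large {zero}  u _ = inj₂ (subst (0 <_) (sym (∣⁅x⁆∣≡1 0F)) (s≤s z≤n))
  subsetSums-full-or-large {suc n} u u≢0 with subsetSums-full-or-large (u ∘ Fin.suc) (u≢0 ∘ Fin.suc)
  ... | inj₁ full = inj₁ λ t → x∈p∪q⁺ (inj₁ (full t))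
  ... | inj₂ n<∣S∣ with any? (λ t → (t ∈? shift (u Fin.zero) (subsetSums (u ∘ Fin.suc))) ×-dec ¬? (t ∈? subsetSums (u ∘ Fin.suc)))
  ...   | yes (t , t∈shift , t∉S) = inj₂ (ℕ.<-≤-trans (s≤s n<∣S∣) (p⊂q⇒∣p∣<∣q∣ (p⊆p∪q _ , t , x∈p∪q⁺ (inj₂ t∈shift) , t∉S)))
  ...   | no noNew = inj₁ λ t → x∈p∪q⁺ (inj₁ (closed⇒full (u≢0 Fin.zero) (0∈subsetSums (u ∘ Fin.suc)) closed t))
    where
    closed : ∀ {t} → t ∈ subsetSums (u ∘ Fin.suc) → t + u Fin.zero ∈ subsetSums (u ∘ Fin.suc)
    closed {t} t∈S with (t + u Fin.zero) ∈? subsetSums (u ∘ Fin.suc)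
    ... | yes t+u₀∈S = t+u₀∈S
    ... | no t+u₀∉S  = contradiction (t + u Fin.zero , ∈-shift⁺ t∈S , t+u₀∉S) noNew

  subsetSums-complete : ∀ {n} (u : Fin n → GF p) → (∀ j → u j ≢ 0F) → p ∸ 1 ≤ n → ∀ t → t ∈ subsetSums u
  subsetSums-complete {n} u u≢0 p-1≤n t with subsetSums-full-or-large u u≢0 | t ∈? subsetSums u
  ... | inj₁ full  | _      = full t
  ... | inj₂ _     | yes t∈ = t∈
  ... | inj₂ n<∣S∣ | no t∉  = ⊥-elim (ℕ.<-irrefl refl (ℕ.<-≤-trans n<∣S∣ (ℕ.≤-trans ∣S∣≤p-1 p-1≤n)))
    where
    ∣S∣≤p-1 : ∣ subsetSums u ∣ ≤ p ∸ 1
    ∣S∣≤p-1 = ℕ.≤-trans (p⊆q⇒∣p∣≤∣q∣ λ {s} s∈S → x∉p⇒x∈∁p λ s∈⁅t⁆ → t∉ (subst (_∈ subsetSums u) (x∈⁅y⁆⇒x≡y t s∈⁅t⁆) s∈S))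
                        (ℕ.≤-reflexive (trans (∣∁p∣≡n∸∣p∣ ⁅ t ⁆) (cong (p ∸_) (∣⁅x⁆∣≡1 t))))

  -- a repetition-free k ∷ L with 1 + Σ x_j⁻¹ = 0; the entry at k is the one that becomes -1
  reachesMinusOne : ∀ {n} (x : Fin n → GF p) → (∀ j → x j ≢ 0F) → p ∸ 1 ≤ n → ReachesMinusOne x
  reachesMinusOne x x≢0 p-1≤n with subsetSums-sound u (subsetSums-complete u (⁻¹-≢0 ∘ x≢0) p-1≤n -1F)
    where
    u : Fin _ → GF p
    u j = x j ⁻¹
  ... | [] , _ , 0≡-1 = contradiction (trans (sym -1F≡-1F) (sym 0≡-1)) (-‿≢0 1F≢0F)
  ... | k ∷ L , unique , Σ≡-1 = walk L unique 1F≢0F (λ j → *-inverseʳ (x≢0 j)) (begin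
    1F + listSum (map (λ j → x j ⁻¹) (k ∷ L))   ≡⟨ cong (1F +_) (trans Σ≡-1 -1F≡-1F) ⟩
    1F + - 1F                                   ≡⟨ +-inverseʳ 1F ⟩
    0F                                          ∎)
    where open ≡-Reasoning

proposition2p5 : (p : ℕ) {{_ : NonZero p}} → Prime p →
    (n : ℕ) → 3 ≤ n → p ∸ 1 ≤ n →
    (x : Fin n → GF p) → IsDiagonal n x →
    Σ (Fin n → GF p) λ x′ →
      IsDiagonal n x′ ×
      (∀ i → toℕ i ≡ 0 → x′ i ≡ -1F) ×
      WeakEquiv (ssr x) (ssr x′)
proposition2p5 p p-prime n 3≤n p-1≤n x (x≢0 , _) with reachesMinusOne p-prime x x≢0 p-1≤n
... | y , y≢0 , (k , yₖ≡-1) , x∼y =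
  y ∘ σ , ((y≢0 ∘ σ) , ssr-isSpikeRep p-prime (y ∘ σ) 2≤n) , first , x∼y ◅◅ weakEquiv-swapIndices p-prime y i₀ k
  where
  2≤n : 2 ≤ n
  2≤n = ℕ.≤-trans (ℕ.n≤1+n 2) 3≤n
  i₀ : Fin n
  i₀ = fromℕ< (ℕ.<-trans (s≤s z≤n) 2≤n)
  σ : Fin n → Fin n
  σ = swapIdx {p} i₀ k
  first : ∀ i → toℕ i ≡ 0 → y (σ i) ≡ -1F
  first i i≡0 = begin
    y (σ i)   ≡⟨ cong (y ∘ σ) (toℕ-injective {i = i} {j = i₀} (trans i≡0 (sym (toℕ-fromℕ< _)))) ⟩
    y (σ i₀)  ≡⟨ cong y (Swap.swapIdx-left {p = p} i₀ k) ⟩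
    y k       ≡⟨ yₖ≡-1 ⟩
    -1F       ∎
    where open ≡-Reasoning
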